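{- For $n\ge 0$ let $B_n$ be the number of king permutations of length $n$ that do not begin with the element $1$, and let $C_n$ be the number of king permutations of length $n$ that neither begin with $1$ nor end with $n$ (so $B_0=C_0=1$, $B_1=C_1=0$). Let $B(t)=\sum_{n\ge0}B_nt^n$ and $C(t)=\sum_{n\ge0}C_nt^n$. Then $$B(t)=\frac{A(t)}{1+t}=\sum_{n\ge0}\frac{n!\,t^n(1-t)^n}{(1+t)^{n+1}},\qquad C(t)=\frac{t}{1+t}+\frac{A(t)}{(1+t)^2}=\frac{t}{1+t}+\sum_{n\ge0}\frac{n!\,t^n(1-t)^n}{(1+t)^{n+2}}.$$ In particular $B(t)=1+2t^4+12t^5+78t^6+568t^7+4674t^8+42948t^9+436358t^{10}+\cdots$ and $C(t)=1+2t^4+10t^5+68t^6+500t^7+4174t^8+38774t^9+397584t^{10}+\cdots$.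
   Context: A permutation $\sigma=\sigma_1\cdots\sigma_n$ of $\{1,\dots,n\}$ is a king permutation if $|\sigma_{i+1}-\sigma_i|>1$ for all $1\le i\le n-1$. Let $K_n$ be the set of king permutations of length $n$ ($K_0$ consists of the empty permutation, $K_1=\{1\}$), and let $A(t)=\sum_{n\ge0}|K_n|t^n$ (formal power series). It is known (Flajolet–Sedgewick) that $A(t)=\sum_{n\ge0}\frac{n!\,t^n(1-t)^n}{(1+t)^n}$. -}

module Defs where

open import Data.Nat as ℕ using (ℕ; zero; suc; _∸_; _<_; ∣_-_∣; _<?_)
open import Data.Nat using (_!)
open import Data.Nat.Combinatorics using (_C_)
open import Data.Integer as ℤ using (ℤ; +_; _-_)
open import Data.Fin using (Fin; toℕ; _≟_)

open import Data.List using (List; []; _∷_; [_]; map; concatMap; filter; length; allFin)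
open import Data.List.Relation.Unary.Unique.Propositional using (Unique)
open import Data.List.Relation.Unary.Linked using (Linked; linked?)
open import Data.Product using (_×_)
open import Data.Empty using (⊥)
open import Relation.Nullary using (Dec; yes; no; ¬_; ¬?)
open import Relation.Nullary.Decidable using (_×-dec_)
open import Relation.Binary.PropositionalEquality using (_≡_)
open import Function using (_∘_)
import Data.Nat.Properties as ℕP
import Data.List.Relation.Unary.Unique.DecPropositional as UDec


-- Permutations of {1,…,n} are encoded as lists over Fin n
-- (value i : Fin n stands for the number toℕ i + 1).

words : (k n : ℕ) → List (List (Fin k))
words k zero    = [ [] ]
words k (suc n) = concatMap (λ x → map (x ∷_) (words k n)) (allFin k)

FarApart : ∀ {n} → Fin n → Fin n → Set
FarApart a b = 1 < ∣ toℕ a - toℕ b ∣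

-- a word of length n over Fin n is a permutation iff its entries are distinct;
-- it is a king permutation iff moreover consecutive entries are far apart
IsKing : ∀ {n} → List (Fin n) → Set
IsKing xs = Unique xs × Linked FarApart xs

BeginsWithOne : ∀ {n} → List (Fin n) → Set
BeginsWithOne []      = ⊥
BeginsWithOne (x ∷ _) = toℕ x ≡ 0

EndsWithMax : ∀ {n} → List (Fin n) → Set
EndsWithMax []           = ⊥
EndsWithMax {n} (x ∷ []) = toℕ x ≡ n ∸ 1
EndsWithMax (x ∷ y ∷ r)  = EndsWithMax (y ∷ r)

isKing? : ∀ {n} (xs : List (Fin n)) → Dec (IsKing xs)
isKing? xs = UDec.unique? _≟_ xs ×-dec linked? (λ a b → 1 <? ∣ toℕ a - toℕ b ∣) xs

beginsWithOne? : ∀ {n} (xs : List (Fin n)) → Dec (BeginsWithOne xs)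
beginsWithOne? []      = no λ ()
beginsWithOne? (x ∷ _) = toℕ x ℕP.≟ 0

endsWithMax? : ∀ {n} (xs : List (Fin n)) → Dec (EndsWithMax xs)
endsWithMax? []           = no λ ()
endsWithMax? {n} (x ∷ []) = toℕ x ℕP.≟ (n ∸ 1)
endsWithMax? (x ∷ y ∷ r)  = endsWithMax? (y ∷ r)

K : (n : ℕ) → List (List (Fin n))
K n = filter isKing? (words n n)

KB : (n : ℕ) → List (List (Fin n))
KB n = filter (¬? ∘ beginsWithOne?) (K n)

KC : (n : ℕ) → List (List (Fin n))
KC n = filter (¬? ∘ endsWithMax?) (KB n)

Acount Bcount Ccount : ℕ → ℕ
Acount n = length (K n)
Bcount n = length (KB n)
Ccount n = length (KC n)

Series : Set
Series = ℕ → ℤ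

Aser : Series
Aser n = + Acount n

-- division by (1 + t): the unique g with (1 + t) g = f,
-- i.e. g₀ = f₀ and g_{m+1} = f_{m+1} - g_m
div1+t : Series → Series
div1+t f zero    = f zero
div1+t f (suc m) = f (suc m) - div1+t f m

tser : Series
tser 1 = + 1
tser _ = + 0

-- the polynomial j! t^j (1 - t)^j, as a series
term : ℕ → Series
term j m with m ℕ.<? j
... | yes _ = + 0
... | no  _ = ℤ.+ (j !) ℤ.* ((ℤ.- + 1) ℤ.^ (m ∸ j) ℤ.* + (j C (m ∸ j)))

div1+t^ : ℕ → Series → Series
div1+t^ zero    f = f
div1+t^ (suc k) f = div1+t (div1+t^ k f)

-- Σ_{j ≥ 0} j! t^j (1-t)^j / (1+t)^(j+k).  The j-th summand is O(t^j),
-- so the coefficient of t^m only receives contributions from j ≤ m.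
sumUpTo : ℕ → (ℕ → ℤ) → ℤ
sumUpTo zero    g = g 0
sumUpTo (suc m) g = sumUpTo m g ℤ.+ g (suc m)

explicitSeries : ℕ → Series
explicitSeries k m = sumUpTo m (λ j → div1+t^ (j ℕ.+ k) (term j) m)

_⊕_ : Series → Series → Series
(f ⊕ g) m = f m ℤ.+ g m

{-# OPTIONS --safe #-}

-- Deleting the initial 1 from a king permutation of length n + 1 that begins with 1, and lowering
-- the other values by one, is a bijection onto the king permutations of length n not beginning
-- with 1; hence A_{n+1} = B_{n+1} + B_n, that is A = (1 + t) B. Likewise deleting the final n + 2
-- from a permutation counted by B_{n+2} that ends with n + 2 leaves one counted by C_{n+1}, so
-- B_{n+2} = C_{n+2} + C_{n+1} and (1 + t) C = B + t.
--
-- The explicit forms then rest on the formula for A, which follows by inclusion–exclusion over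
-- sets J of bonds {j, j + 1}: A_{n+1} = Σ_J (-1)^|J| N(J), where N(J) is the number of permutations
-- of 0 … n in which the two values of every bond of J are adjacent. Inserting the largest value into
-- the gaps of a smaller permutation shows that N(J) is a product of factors (the number of blocks of
-- J plus one, or the 1 or 2 free sides of the top value), and an induction on n that keeps track of
-- the number of blocks and of the top bond identifies the signed sum with the coefficient of
-- t^(n+1) in Σ_j j! t^j (1 - t)^j / (1 + t)^j.

module Submission where

open import Defs
open import Data.Nat using (ℕ)
open import Data.Integer using (+_)
open import Data.List using (List; []; _∷_; map; upTo)
open import Data.Product using (_×_; _,_)
open import Relation.Binary.PropositionalEquality using (_≡_)

module ListCounting where

  open import Data.Nat as ℕ using (ℕ; suc; _≤_; _<_)
  import Data.Nat.Properties as ℕP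
  open import Data.Integer as ℤ using (ℤ; +_; _+_; _*_)
  import Data.Integer.Properties as ℤP
  open import Algebra.Properties.CommutativeSemigroup ℤP.+-commutativeSemigroup using () renaming (interchange to +-interchange)
  open import Data.List using (List; []; _∷_; _++_; map; filter; length; concatMap; upTo)
  import Data.List.Properties as LP
  open import Data.List.Membership.Propositional using (_∈_; find)
  open import Data.List.Membership.Propositional.Properties
    using (∈-map⁺; ∈-map⁻; ∈-filter⁺; ∈-filter⁻; ∈-upTo⁺; ∈-concatMap⁻)
  open import Data.List.Membership.DecPropositional ℕP._≟_ using (_∈?_)
  open import Data.List.Membership.Propositional.Properties.WithK using (unique∧set⇒bag)
  open import Data.List.Relation.Binary.BagAndSetEquality using (∼bag⇒↭)
  open import Data.List.Relation.Binary.Permutation.Propositional.Properties using (↭-length)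
  open import Data.List.Relation.Unary.Any using (here; there)
  open import Data.List.Relation.Unary.All as All using (All; []; _∷_)
  open import Data.List.Relation.Unary.Unique.Propositional using (Unique; []; _∷_)
  import Data.List.Relation.Unary.Unique.Propositional.Properties as Unique
  open import Data.Product using (_×_; _,_; ∃; proj₂)
  open import Data.Empty using (⊥)
  open import Data.Bool using (true; false; if_then_else_)
  open import Function using (_∘_; Injective; _⇔_; mk⇔)
  open import Relation.Nullary using (yes; no; does)
  open import Relation.Unary using (Decidable)
  open import Relation.Unary.Properties using (_∩?_; ∁?)
  open import Relation.Binary.PropositionalEquality

  private variable
    A B : Set

  sumBy : (A → ℤ) → List A → ℤ
  sumBy f []       = + 0
  sumBy f (x ∷ xs) = f x + sumBy f xs

  module _ {f g : A → ℤ} where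

    sumBy-cong : ∀ xs → (∀ x → f x ≡ g x) → sumBy f xs ≡ sumBy g xs
    sumBy-cong []       f≗g = refl
    sumBy-cong (x ∷ xs) f≗g = cong₂ _+_ (f≗g x) (sumBy-cong xs f≗g)

    sumBy-cong-∈ : ∀ xs → (∀ {x} → x ∈ xs → f x ≡ g x) → sumBy f xs ≡ sumBy g xs
    sumBy-cong-∈ []       f≗g = refl
    sumBy-cong-∈ (x ∷ xs) f≗g = cong₂ _+_ (f≗g (here refl)) (sumBy-cong-∈ xs (f≗g ∘ there))

    sumBy-+ : ∀ xs → sumBy (λ x → f x + g x) xs ≡ sumBy f xs + sumBy g xs
    sumBy-+ []       = refl
    sumBy-+ (x ∷ xs) = trans (cong (_+_ (f x + g x)) (sumBy-+ xs)) (+-interchange (f x) (g x) _ _)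

  sumBy-++ : ∀ (f : A → ℤ) xs ys → sumBy f (xs ++ ys) ≡ sumBy f xs + sumBy f ys
  sumBy-++ f []       ys = sym (ℤP.+-identityˡ _)
  sumBy-++ f (x ∷ xs) ys = trans (cong (_+_ (f x)) (sumBy-++ f xs ys)) (sym (ℤP.+-assoc (f x) _ _))

  sumBy-map : ∀ (f : B → ℤ) (g : A → B) xs → sumBy f (map g xs) ≡ sumBy (λ x → f (g x)) xs
  sumBy-map f g []       = refl
  sumBy-map f g (x ∷ xs) = cong (_+_ (f (g x))) (sumBy-map f g xs)

  sumBy-concatMap : ∀ (f : B → ℤ) (g : A → List B) xs →
                    sumBy f (concatMap g xs) ≡ sumBy (λ x → sumBy f (g x)) xs
  sumBy-concatMap f g []       = refl
  sumBy-concatMap f g (x ∷ xs) = trans (sumBy-++ f (g x) (concatMap g xs)) (cong (_+_ (sumBy f (g x))) (sumBy-concatMap f g xs))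

  sumBy-*ˡ : ∀ c (f : A → ℤ) xs → sumBy (λ x → c * f x) xs ≡ c * sumBy f xs
  sumBy-*ˡ c f []       = sym (ℤP.*-zeroʳ c)
  sumBy-*ˡ c f (x ∷ xs) = trans (cong (_+_ (c * f x)) (sumBy-*ˡ c f xs)) (sym (ℤP.*-distribˡ-+ c (f x) _))

  sumBy-zero : ∀ (xs : List A) → sumBy (λ _ → + 0) xs ≡ + 0
  sumBy-zero []       = refl
  sumBy-zero (x ∷ xs) = trans (ℤP.+-identityˡ _) (sumBy-zero xs)

  sumBy-comm : ∀ (g : A → B → ℤ) xs ys →
               sumBy (λ x → sumBy (g x) ys) xs ≡ sumBy (λ y → sumBy (λ x → g x y) xs) ys
  sumBy-comm g []       ys = sym (sumBy-zero ys)
  sumBy-comm g (x ∷ xs) ys = trans (cong (_+_ (sumBy (g x) ys)) (sumBy-comm g xs ys)) (sym (sumBy-+ ys))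

  module _ {P : A → Set} (P? : Decidable P) where

    length-filter≡sumBy : ∀ xs → + length (filter P? xs) ≡ sumBy (λ x → if does (P? x) then + 1 else + 0) xs
    length-filter≡sumBy []       = refl
    length-filter≡sumBy (x ∷ xs) with does (P? x)
    ... | true  = trans (ℤP.pos-+ 1 _) (cong (_+_ (+ 1)) (length-filter≡sumBy xs))
    ... | false = trans (length-filter≡sumBy xs) (sym (ℤP.+-identityˡ _))

  module _ {P Q : A → Set} (P? : Decidable P) (Q? : Decidable Q) where

    filter-filter : ∀ xs → filter P? (filter Q? xs) ≡ filter (Q? ∩? P?) xs
    filter-filter []       = refl
    filter-filter (x ∷ xs) with Q? x
    ... | no  _ = filter-filter xs
    ... | yes _ with P? x
    ...   | yes _ = cong (x ∷_) (filter-filter xs)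
    ...   | no  _ = filter-filter xs

  module _ {P : A → Set} (P? : Decidable P) where

    length-filter+length-filter-∁ : ∀ xs → length (filter P? xs) ℕ.+ length (filter (∁? P?) xs) ≡ length xs
    length-filter+length-filter-∁ []       = refl
    length-filter+length-filter-∁ (x ∷ xs) with P? x
    ... | yes _ = cong suc (length-filter+length-filter-∁ xs)
    ... | no  _ = trans (ℕP.+-suc _ _) (cong suc (length-filter+length-filter-∁ xs))

  length-unique-⇔ : {xs ys : List A} → Unique xs → Unique ys → (∀ {z} → z ∈ xs ⇔ z ∈ ys) → length xs ≡ length ys
  length-unique-⇔ uxs uys xs⇔ys = ↭-length (∼bag⇒↭ (unique∧set⇒bag uxs uys xs⇔ys))

  length-filter-bijection :
    ∀ {P : A → Set} {Q : B → Set} (P? : Decidable P) (Q? : Decidable Q) {xs ys} (f : A → B) →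
    Injective _≡_ _≡_ f → Unique xs → Unique ys →
    (∀ {x} → x ∈ xs → P x → f x ∈ ys × Q (f x)) →
    (∀ {y} → y ∈ ys → Q y → ∃ λ x → x ∈ xs × P x × f x ≡ y) →
    length (filter P? xs) ≡ length (filter Q? ys)
  length-filter-bijection P? Q? {xs} {ys} f f-inj uxs uys to from = begin
    length (filter P? xs)
      ≡⟨ LP.length-map f (filter P? xs) ⟨
    length (map f (filter P? xs))
      ≡⟨ length-unique-⇔ (Unique.map⁺ f-inj (Unique.filter⁺ P? uxs)) (Unique.filter⁺ Q? uys) (mk⇔ image⊆ ⊆image) ⟩
    length (filter Q? ys) ∎
    where
    open ≡-Reasoning
    image⊆ : ∀ {y} → y ∈ map f (filter P? xs) → y ∈ filter Q? ys
    image⊆ y∈ with x , x∈ , refl ← ∈-map⁻ f y∈ with x∈xs , Px ← ∈-filter⁻ P? x∈ with fx∈ys , Qfx ← to x∈xs Px =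
      ∈-filter⁺ Q? fx∈ys Qfx
    ⊆image : ∀ {y} → y ∈ filter Q? ys → y ∈ map f (filter P? xs)
    ⊆image y∈ with y∈ys , Qy ← ∈-filter⁻ Q? y∈ with x , x∈xs , Px , refl ← from y∈ys Qy =
      ∈-map⁺ f (∈-filter⁺ P? x∈xs Px)

  length-unique-bounded : ∀ {v xs} → Unique xs → All (_< v) xs → length xs ≤ v
  length-unique-bounded {v} {xs} uxs xs<v = begin
    length xs                   ≡⟨ length-unique-⇔ uxs (Unique.filter⁺ (_∈? xs) (Unique.upTo⁺ v)) (mk⇔ into back) ⟩
    length (filter (_∈? xs) (upTo v)) ≤⟨ LP.length-filter (_∈? xs) (upTo v) ⟩
    length (upTo v)             ≡⟨ LP.length-upTo v ⟩
    v                           ∎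
    where
    open ℕP.≤-Reasoning
    into : ∀ {z} → z ∈ xs → z ∈ filter (_∈? xs) (upTo v)
    into z∈ = ∈-filter⁺ (_∈? xs) {xs = upTo v} (∈-upTo⁺ (All.lookup xs<v z∈)) z∈
    back : ∀ {z} → z ∈ filter (_∈? xs) (upTo v) → z ∈ xs
    back z∈ = proj₂ (∈-filter⁻ (_∈? xs) {xs = upTo v} z∈)

  Unique-concatMap : ∀ (f : A → List B) {xs} → Unique xs → (∀ {x} → x ∈ xs → Unique (f x)) →
                     (∀ {x y z} → x ∈ xs → y ∈ xs → z ∈ f x → z ∈ f y → x ≡ y) →
                     Unique (concatMap f xs)
  Unique-concatMap f {[]}     []         _     _    = []
  Unique-concatMap f {x ∷ xs} (x∉ ∷ uxs) ufx   f-disj =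
    Unique.++⁺ (ufx (here refl)) (Unique-concatMap f uxs (ufx ∘ there) (λ p q → f-disj (there p) (there q))) disjoint
    where
    disjoint : ∀ {z} → z ∈ f x × z ∈ concatMap f xs → ⊥
    disjoint (z∈fx , z∈rest) with y , y∈xs , z∈fy ← find (∈-concatMap⁻ f z∈rest) =
      All.lookup x∉ y∈xs (f-disj (here refl) (there y∈xs) z∈fx z∈fy)

  length-filter-split : ∀ {P Q : A → Set} (P? : Decidable P) (Q? : Decidable Q) xs →
                        length (filter P? xs) ≡ length (filter (P? ∩? ∁? Q?) xs) ℕ.+ length (filter (P? ∩? Q?) xs)
  length-filter-split P? Q? xs = begin
    length (filter P? xs)
      ≡⟨ length-filter+length-filter-∁ Q? (filter P? xs) ⟨
    length (filter Q? (filter P? xs)) ℕ.+ length (filter (∁? Q?) (filter P? xs))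
      ≡⟨ ℕP.+-comm (length (filter Q? (filter P? xs))) _ ⟩
    length (filter (∁? Q?) (filter P? xs)) ℕ.+ length (filter Q? (filter P? xs))
      ≡⟨ cong₂ ℕ._+_ (cong length (filter-filter (∁? Q?) P? xs)) (cong length (filter-filter Q? P? xs)) ⟩
    length (filter (P? ∩? ∁? Q?) xs) ℕ.+ length (filter (P? ∩? Q?) xs) ∎
    where open ≡-Reasoning

module PowerSeries where

  open import Data.Nat as ℕ using (ℕ; zero; suc; _<_; s≤s; _!)
  import Data.Nat.Properties as ℕP
  open import Data.Nat.Combinatorics using (_C_; nCk+nC[k+1]≡[n+1]C[k+1])
  open import Data.Integer as ℤ using (ℤ; +_; _-_; -_; _+_; _*_; _^_)
  import Data.Integer.Properties as ℤP
  open import Data.Integer.Tactic.RingSolver using (solve-∀)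
  open import Algebra.Properties.CommutativeSemigroup ℤP.+-commutativeSemigroup using () renaming (interchange to +-interchange)
  open import Data.Empty using (⊥-elim)
  open import Data.Sum using (inj₁; inj₂)
  open import Data.Product using (_,_)
  open import Relation.Nullary using (yes; no)
  open import Relation.Binary.PropositionalEquality

  div1+t-cong : ∀ {f g : Series} → (∀ m → f m ≡ g m) → ∀ m → div1+t f m ≡ div1+t g m
  div1+t-cong f≗g zero    = f≗g zero
  div1+t-cong f≗g (suc m) = cong₂ _-_ (f≗g (suc m)) (div1+t-cong f≗g m)

  div1+t-linear : ∀ a b (f g : Series) m →
                  div1+t (λ i → a * f i + b * g i) m ≡ a * div1+t f m + b * div1+t g m
  div1+t-linear a b f g zero    = refl
  div1+t-linear a b f g (suc m) =
    trans (cong (_-_ (a * f (suc m) + b * g (suc m))) (div1+t-linear a b f g m))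
          (distrib a b (f (suc m)) (g (suc m)) (div1+t f m) (div1+t g m))
    where
    distrib : ∀ a b x y u v → (a * x + b * y) - (a * u + b * v) ≡ a * (x - u) + b * (y - v)
    distrib = solve-∀

  shift : Series → Series
  shift f zero    = + 0
  shift f (suc m) = f m

  div1+t-shift : ∀ (f : Series) m → div1+t (shift f) m ≡ shift (div1+t f) m
  div1+t-shift f zero          = refl
  div1+t-shift f (suc zero)    = ℤP.+-identityʳ (f 0)
  div1+t-shift f (suc (suc m)) = cong (_-_ (f (suc m))) (div1+t-shift f (suc m))

  div1+t^-zero : ∀ (f : Series) k → div1+t^ k f 0 ≡ f 0
  div1+t^-zero f zero    = refl
  div1+t^-zero f (suc k) = div1+t^-zero f k

  VanishesBelow : ℕ → Series → Set
  VanishesBelow j f = ∀ i → i < j → f i ≡ + 0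

  div1+t-vanishesBelow : ∀ {f} j → VanishesBelow j f → VanishesBelow j (div1+t f)
  div1+t-vanishesBelow j f≈0 zero    i<j = f≈0 zero i<j
  div1+t-vanishesBelow j f≈0 (suc i) i<j =
    cong₂ _-_ (f≈0 (suc i) i<j) (div1+t-vanishesBelow j f≈0 i (ℕP.<-trans (ℕP.n<1+n i) i<j))

  div1+t^-vanishesBelow : ∀ {f} k j → VanishesBelow j f → VanishesBelow j (div1+t^ k f)
  div1+t^-vanishesBelow zero    j f≈0 = f≈0
  div1+t^-vanishesBelow (suc k) j f≈0 = div1+t-vanishesBelow j (div1+t^-vanishesBelow k j f≈0)

  shift-vanishesBelow : ∀ {f} j → VanishesBelow j f → shift f j ≡ + 0
  shift-vanishesBelow zero    f≈0 = refl
  shift-vanishesBelow (suc j) f≈0 = f≈0 j (ℕP.n<1+n j)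

  term-vanishesBelow : ∀ j → VanishesBelow j (term j)
  term-vanishesBelow j m m<j with m ℕ.<? j
  ... | yes _ = refl
  ... | no m≮j = ⊥-elim (m≮j m<j)

  term-+ : ∀ j d → term j (j ℕ.+ d) ≡ + (j !) * ((- + 1) ^ d * + (j C d))
  term-+ j d with (j ℕ.+ d) ℕ.<? j
  ... | yes j+d<j = ⊥-elim (ℕP.m+n≮m j d j+d<j)
  ... | no  _     = cong (λ e → + (j !) * ((- + 1) ^ e * + (j C e))) (ℕP.m+n∸m≡n j d)

  term-suc-+ : ∀ k d → term (suc k) (suc k ℕ.+ d) ≡ + suc k * (term k (k ℕ.+ d) - shift (term k) (k ℕ.+ d))
  term-suc-+ k zero = begin
    term (suc k) (suc k ℕ.+ 0)                              ≡⟨ term-+ (suc k) 0 ⟩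
    + (suc k ℕ.* k !) * (+ 1 * + 1)                         ≡⟨ cong (_* (+ 1 * + 1)) (ℤP.pos-* (suc k) (k !)) ⟩
    + suc k * + (k !) * (+ 1 * + 1)                         ≡⟨ regroup (+ suc k) (+ (k !)) ⟩
    + suc k * (+ (k !) * (+ 1 * + 1) - + 0)                 ≡⟨ cong₂ (λ u v → + suc k * (u - v)) (term-+ k 0) t·term≈0 ⟨
    + suc k * (term k (k ℕ.+ 0) - shift (term k) (k ℕ.+ 0)) ∎
    where
    open ≡-Reasoning
    regroup : ∀ c F → c * F * (+ 1 * + 1) ≡ c * (F * (+ 1 * + 1) - + 0)
    regroup = solve-∀
    t·term≈0 : shift (term k) (k ℕ.+ 0) ≡ + 0
    t·term≈0 = shift-vanishesBelow (k ℕ.+ 0) (λ i i<k → term-vanishesBelow k i (ℕP.<-≤-trans i<k (ℕP.≤-reflexive (ℕP.+-identityʳ k))))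
  term-suc-+ k (suc e) = begin
    term (suc k) (suc k ℕ.+ suc e)
      ≡⟨ term-+ (suc k) (suc e) ⟩
    + (suc k ℕ.* k !) * (- + 1 * s * + (suc k C suc e))
      ≡⟨ cong (λ c → + (suc k ℕ.* k !) * (- + 1 * s * + c)) (nCk+nC[k+1]≡[n+1]C[k+1] k e) ⟨
    + (suc k ℕ.* k !) * (- + 1 * s * + (k C e ℕ.+ k C suc e))
      ≡⟨ cong₂ (λ u v → u * (- + 1 * s * v)) (ℤP.pos-* (suc k) (k !)) (ℤP.pos-+ (k C e) (k C suc e)) ⟩
    + suc k * + (k !) * (- + 1 * s * (+ (k C e) + + (k C suc e)))
      ≡⟨ pascal (+ suc k) (+ (k !)) s (+ (k C e)) (+ (k C suc e)) ⟩
    + suc k * (+ (k !) * (- + 1 * s * + (k C suc e)) - + (k !) * (s * + (k C e)))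
      ≡⟨ cong₂ (λ u v → + suc k * (u - v)) (term-+ k (suc e)) (term-+ k e) ⟨
    + suc k * (term k (k ℕ.+ suc e) - term k (k ℕ.+ e))
      ≡⟨ cong (λ u → + suc k * (term k (k ℕ.+ suc e) - shift (term k) u)) (ℕP.+-suc k e) ⟨
    + suc k * (term k (k ℕ.+ suc e) - shift (term k) (k ℕ.+ suc e)) ∎
    where
    open ≡-Reasoning
    s = (- + 1) ^ e
    pascal : ∀ c F s a b → c * F * (- + 1 * s * (a + b)) ≡ c * (F * (- + 1 * s * b) - F * (s * a))
    pascal = solve-∀

  -- j! t^j (1 - t)^j = j t (1 - t) · (j - 1)! t^(j-1) (1 - t)^(j-1)
  term-suc : ∀ k m → term (suc k) m ≡ + suc k * (shift (term k) m - shift (shift (term k)) m)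
  term-suc k zero = sym (ℤP.*-zeroʳ (+ suc k))
  term-suc k (suc m) with ℕP.<-≤-connex m k
  ... | inj₂ k≤m with d , refl ← ℕP.m≤n⇒∃[o]m+o≡n k≤m = term-suc-+ k d
  ... | inj₁ m<k = begin
    term (suc k) (suc m)                     ≡⟨ term-vanishesBelow (suc k) (suc m) (s≤s m<k) ⟩
    + 0                                      ≡⟨ ℤP.*-zeroʳ (+ suc k) ⟨
    + suc k * (+ 0 - + 0)                    ≡⟨ cong₂ (λ u v → + suc k * (u - v)) (term-vanishesBelow k m m<k) t·term≈0 ⟨
    + suc k * (term k m - shift (term k) m)  ∎
    where
    open ≡-Reasoning
    t·term≈0 : shift (term k) m ≡ + 0
    t·term≈0 = shift-vanishesBelow m (λ i i<m → term-vanishesBelow k i (ℕP.<-trans i<m m<k))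

  div1+t^-term-suc : ∀ ℓ k m →
    div1+t^ ℓ (term (suc k)) m ≡ + suc k * (shift (div1+t^ ℓ (term k)) m - shift (shift (div1+t^ ℓ (term k))) m)
  div1+t^-term-suc zero    k m = term-suc k m
  div1+t^-term-suc (suc ℓ) k m = begin
    div1+t (div1+t^ ℓ (term (suc k))) m
      ≡⟨ div1+t-cong (λ i → trans (div1+t^-term-suc ℓ k i) (split c (shift G i) (shift (shift G) i))) m ⟩
    div1+t (λ i → c * shift G i + (- c) * shift (shift G) i) m
      ≡⟨ div1+t-linear c (- c) (shift G) (shift (shift G)) m ⟩
    c * div1+t (shift G) m + (- c) * div1+t (shift (shift G)) m
      ≡⟨ cong₂ (λ u v → c * u + (- c) * v) (div1+t-shift G m) (trans (div1+t-shift (shift G) m) (shift-div1+t-shift m)) ⟩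
    c * shift (div1+t G) m + (- c) * shift (shift (div1+t G)) m
      ≡⟨ split c (shift (div1+t G) m) (shift (shift (div1+t G)) m) ⟨
    c * (shift (div1+t G) m - shift (shift (div1+t G)) m) ∎
    where
    open ≡-Reasoning
    c = + suc k
    G = div1+t^ ℓ (term k)
    split : ∀ c x y → c * (x - y) ≡ c * x + (- c) * y
    split = solve-∀
    shift-div1+t-shift : ∀ m → shift (div1+t (shift G)) m ≡ shift (shift (div1+t G)) m
    shift-div1+t-shift zero    = refl
    shift-div1+t-shift (suc m) = div1+t-shift G m

  summand : ℕ → Series
  summand j = div1+t^ j (term j)

  summand-vanishesBelow : ∀ j → VanishesBelow j (summand j)
  summand-vanishesBelow j = div1+t^-vanishesBelow j j (term-vanishesBelow j)

  summand-0 : ∀ m → summand 0 (suc m) ≡ + 0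
  summand-0 m = trans (term-+ 0 (suc m)) (cong (+ 1 *_) (ℤP.*-zeroʳ ((- + 1) ^ suc m)))

  summand-suc : ∀ k n → summand (suc k) (suc (suc n)) + summand (suc k) (suc n) ≡ + suc k * (summand k (suc n) - summand k n)
  summand-suc k n = trans (cancel (div1+t^ k (term (suc k)) (suc (suc n))) (summand (suc k) (suc n)))
                          (div1+t^-term-suc k k (suc (suc n)))
    where
    cancel : ∀ g x → (g - x) + x ≡ g
    cancel = solve-∀

  sumUpTo-cong : ∀ m {f g : ℕ → ℤ} → (∀ j → f j ≡ g j) → sumUpTo m f ≡ sumUpTo m g
  sumUpTo-cong zero    f≗g = f≗g 0
  sumUpTo-cong (suc m) f≗g = cong₂ _+_ (sumUpTo-cong m f≗g) (f≗g (suc m))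

  sumUpTo-+ : ∀ m (f g : ℕ → ℤ) → sumUpTo m (λ j → f j + g j) ≡ sumUpTo m f + sumUpTo m g
  sumUpTo-+ zero    f g = refl
  sumUpTo-+ (suc m) f g = trans (cong (_+ (f (suc m) + g (suc m))) (sumUpTo-+ m f g)) (+-interchange (sumUpTo m f) (sumUpTo m g) (f (suc m)) (g (suc m)))

  sumUpTo-- : ∀ m (f g : ℕ → ℤ) → sumUpTo m (λ j → f j - g j) ≡ sumUpTo m f - sumUpTo m g
  sumUpTo-- zero    f g = refl
  sumUpTo-- (suc m) f g = trans (cong (_+ (f (suc m) - g (suc m))) (sumUpTo-- m f g)) (interchange (sumUpTo m f) (sumUpTo m g) (f (suc m)) (g (suc m)))
    where
    interchange : ∀ a b c d → (a - b) + (c - d) ≡ (a + c) - (b + d)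
    interchange = solve-∀

  sumUpTo-suc : ∀ m (f : ℕ → ℤ) → sumUpTo (suc m) f ≡ f 0 + sumUpTo m (λ j → f (suc j))
  sumUpTo-suc zero    f = refl
  sumUpTo-suc (suc m) f = trans (cong (_+ f (suc (suc m))) (sumUpTo-suc m f)) (ℤP.+-assoc (f 0) _ _)

  -- The summand of index m + 1 vanishes at m, so truncating the sums at m and at m + 1 agree.
  explicitSeries-suc : ∀ k m → explicitSeries (suc k) m ≡ div1+t (explicitSeries k) m
  explicitSeries-suc k zero    = trans (div1+t^-zero (term 0) (suc k)) (sym (div1+t^-zero (term 0) k))
  explicitSeries-suc k (suc m) = begin
    sumUpTo (suc m) (λ j → div1+t^ (j ℕ.+ suc k) (term j) (suc m))
      ≡⟨ sumUpTo-cong (suc m) (λ j → cong (λ e → div1+t^ e (term j) (suc m)) (ℕP.+-suc j k)) ⟩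
    sumUpTo (suc m) (λ j → div1+t^ (j ℕ.+ k) (term j) (suc m) - div1+t^ (suc j ℕ.+ k) (term j) m)
      ≡⟨ sumUpTo-- (suc m) _ _ ⟩
    explicitSeries k (suc m) - (sumUpTo m (λ j → div1+t^ (suc j ℕ.+ k) (term j) m) + div1+t^ (suc (suc m) ℕ.+ k) (term (suc m)) m)
      ≡⟨ cong₂ (λ u v → explicitSeries k (suc m) - (u + v))
               (sym (sumUpTo-cong m (λ j → cong (λ e → div1+t^ e (term j) m) (ℕP.+-suc j k))))
               (div1+t^-vanishesBelow (suc (suc m) ℕ.+ k) (suc m) (term-vanishesBelow (suc m)) m (ℕP.n<1+n m)) ⟩
    explicitSeries k (suc m) - (explicitSeries (suc k) m + + 0)
      ≡⟨ cong (_-_ (explicitSeries k (suc m))) (trans (ℤP.+-identityʳ _) (explicitSeries-suc k m)) ⟩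
    div1+t (explicitSeries k) (suc m) ∎
    where open ≡-Reasoning

  div1+t-unique : ∀ (f g : Series) → g 0 ≡ f 0 → (∀ m → g (suc m) + g m ≡ f (suc m)) → ∀ n → g n ≡ div1+t f n
  div1+t-unique f g g₀ step zero    = g₀
  div1+t-unique f g g₀ step (suc m) = begin
    g (suc m)                    ≡⟨ cancel (g (suc m)) (g m) ⟨
    (g (suc m) + g m) - g m      ≡⟨ cong₂ _-_ (step m) (div1+t-unique f g g₀ step m) ⟩
    f (suc m) - div1+t f m       ∎
    where
    open ≡-Reasoning
    cancel : ∀ a b → (a + b) - b ≡ a
    cancel = solve-∀

  div1+t-⊕ : ∀ (f g : Series) n → div1+t (f ⊕ g) n ≡ (div1+t f ⊕ div1+t g) n
  div1+t-⊕ f g zero    = refl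
  div1+t-⊕ f g (suc m) = trans (cong (_-_ ((f ⊕ g) (suc m))) (div1+t-⊕ f g m)) (interchange (f (suc m)) (g (suc m)) (div1+t f m) (div1+t g m))
    where
    interchange : ∀ a b c d → (a + b) - (c + d) ≡ (a - c) + (b - d)
    interchange = solve-∀

module BondSets where

  open ListCounting
  open PowerSeries
  open import Data.Nat as ℕ using (ℕ; zero; suc)
  import Data.Nat.Properties as ℕP
  open import Data.Integer as ℤ using (ℤ; +_; _-_; -_; _+_; _*_)
  import Data.Integer.Properties as ℤP
  open import Data.Integer.Tactic.RingSolver using (solve-∀)
  open import Data.Bool using (Bool; true; false)
  open import Data.Vec using (Vec; []; _∷_)
  open import Data.List using (List; []; _∷_; concatMap)
  open import Relation.Binary.PropositionalEquality

  -- A bond set J : Vec Bool n selects among the bonds {j, j + 1}, j < n, of the values 0 … n;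
  -- its head is the top bond {n - 1, n}.
  bondSets : (n : ℕ) → List (Vec Bool n)
  bondSets zero    = [] ∷ []
  bondSets (suc n) = concatMap (λ J → (false ∷ J) ∷ (true ∷ J) ∷ []) (bondSets n)

  blocks : ∀ {n} → Vec Bool n → ℕ
  blocks []          = 1
  blocks (false ∷ J) = suc (blocks J)
  blocks (true ∷ J)  = blocks J

  topBond : ∀ {n} → Vec Bool n → Bool
  topBond []      = false
  topBond (b ∷ _) = b

  -- the number of sides of the top value n at which the next value n + 1 can be glued
  freeSides : Bool → ℕ
  freeSides true  = 1
  freeSides false = 2

  -- the number of permutations of 0 … n in which all bonds of J are adjacent pairs
  arrangements : ∀ {n} → Vec Bool n → ℕ
  arrangements []          = 1
  arrangements (false ∷ J) = suc (blocks J) ℕ.* arrangements J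
  arrangements (true ∷ J)  = freeSides (topBond J) ℕ.* arrangements J

  sign : ∀ {n} → Vec Bool n → ℤ
  sign []          = + 1
  sign (false ∷ J) = sign J
  sign (true ∷ J)  = - sign J

  -- The signed number of arrangements of the bond sets J ⊆ {0 … n - 1} with m blocks
  -- whose top bond is absent (free) or present (bonded).
  freeWeight bondedWeight : ℕ → ℕ → ℤ
  freeWeight n zero    = + 0
  freeWeight n (suc k) = + suc k * summand k n
  bondedWeight n m = summand m (suc n) - freeWeight n m

  freeWeight+bondedWeight : ∀ n m → freeWeight n m + bondedWeight n m ≡ summand m (suc n)
  freeWeight+bondedWeight n m = cancel (freeWeight n m) (summand m (suc n))
    where
    cancel : ∀ x h → x + (h - x) ≡ h
    cancel = solve-∀

  bondedWeight-suc : ∀ n m → bondedWeight (suc n) m ≡ - (+ 2 * freeWeight n m + bondedWeight n m)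
  bondedWeight-suc n zero    = trans (cong (_- + 0) (summand-0 (suc n)))
                                     (cong (λ z → - (+ 2 * + 0 + (z - + 0))) (sym (summand-0 n)))
  bondedWeight-suc n (suc k) = begin
    a - c * x                       ≡⟨ cancel a b (c * x) ⟩
    ((a + b) - b) - c * x           ≡⟨ cong (λ z → (z - b) - c * x) (summand-suc k n) ⟩
    (c * (x - y) - b) - c * x       ≡⟨ regroup c x y b ⟩
    - (+ 2 * (c * y) + (b - c * y)) ∎
    where
    open ≡-Reasoning
    a = summand (suc k) (suc (suc n))
    b = summand (suc k) (suc n)
    c = + suc k
    x = summand k (suc n)
    y = summand k n
    cancel : ∀ a b x → a - x ≡ ((a + b) - b) - x
    cancel = solve-∀
    regroup : ∀ c x y b → (c * (x - y) - b) - c * x ≡ - (+ 2 * (c * y) + (b - c * y))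
    regroup = solve-∀

  weights-vanish : ∀ n → bondedWeight (suc n) (suc (suc n)) ≡ + 0
  weights-vanish n = begin
    bondedWeight (suc n) (suc (suc n))                                                    ≡⟨ bondedWeight-suc n (suc (suc n)) ⟩
    - (+ 2 * (c * summand (suc n) n) + (summand (suc (suc n)) (suc n) - c * summand (suc n) n))
      ≡⟨ cong₂ (λ u v → - (+ 2 * (c * u) + (v - c * u))) (vanish n) (vanish (suc n)) ⟩
    - (+ 2 * (c * + 0) + (+ 0 - c * + 0))                                                 ≡⟨ simplify c ⟩
    + 0                                                                                   ∎
    where
    open ≡-Reasoning
    c = + suc (suc n)
    vanish : ∀ i → summand (suc i) i ≡ + 0
    vanish i = summand-vanishesBelow (suc i) i (ℕP.n<1+n i)
    simplify : ∀ c → - (+ 2 * (c * + 0) + (+ 0 - c * + 0)) ≡ + 0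
    simplify = solve-∀

  signedSum : ℕ → (ℕ → Bool → ℤ) → ℤ
  signedSum n φ = sumBy (λ J → sign J * + arrangements J * φ (blocks J) (topBond J)) (bondSets n)

  blockSum : ℕ → (ℕ → Bool → ℤ) → ℤ
  blockSum n φ = sumUpTo (suc n) (λ m → freeWeight n m * φ m false + bondedWeight n m * φ m true)

  glue : (ℕ → Bool → ℤ) → ℕ → Bool → ℤ
  glue φ m b = + suc m * φ (suc m) false - + freeSides b * φ m true

  signedSum-suc : ∀ n φ → signedSum (suc n) φ ≡ signedSum n (glue φ)
  signedSum-suc n φ = trans (sumBy-concatMap T (λ J → (false ∷ J) ∷ (true ∷ J) ∷ []) (bondSets n))
                            (sumBy-cong (bondSets n) split)
    where
    T : Vec Bool (suc n) → ℤ
    T J = sign J * + arrangements J * φ (blocks J) (topBond J)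
    regroup : ∀ s a c N x y → s * (a * N) * x + ((- s) * (c * N) * y + + 0) ≡ s * N * (a * x - c * y)
    regroup = solve-∀
    split : ∀ J → T (false ∷ J) + (T (true ∷ J) + + 0) ≡ sign J * + arrangements J * glue φ (blocks J) (topBond J)
    split J = trans (cong₂ (λ u v → sign J * u * φ (suc (blocks J)) false + ((- sign J) * v * φ (blocks J) true + + 0))
                           (ℤP.pos-* (suc (blocks J)) (arrangements J)) (ℤP.pos-* (freeSides (topBond J)) (arrangements J)))
                    (regroup (sign J) (+ suc (blocks J)) (+ freeSides (topBond J)) (+ arrangements J)
                             (φ (suc (blocks J)) false) (φ (blocks J) true))

  blockSum-glue : ∀ n φ → blockSum n (glue φ) ≡ blockSum (suc n) φ
  blockSum-glue n φ = begin
    blockSum n (glue φ)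
      ≡⟨ sumUpTo-cong (suc n) weights-suc ⟩
    sumUpTo (suc n) (λ m → a (suc m) + b m)
      ≡⟨ sumUpTo-+ (suc n) (λ m → a (suc m)) b ⟩
    sumUpTo (suc n) (λ m → a (suc m)) + sumUpTo (suc n) b
      ≡⟨ pad (sumUpTo (suc n) (λ m → a (suc m))) (sumUpTo (suc n) b) (a 0) (b (suc (suc n))) (ℤP.*-zeroˡ (φ 0 false)) b-last ⟩
    (a 0 + sumUpTo (suc n) (λ m → a (suc m))) + (sumUpTo (suc n) b + b (suc (suc n)))
      ≡⟨ cong (_+ sumUpTo (suc (suc n)) b) (sumUpTo-suc (suc n) a) ⟨
    sumUpTo (suc (suc n)) a + sumUpTo (suc (suc n)) b
      ≡⟨ sumUpTo-+ (suc (suc n)) a b ⟨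
    blockSum (suc n) φ ∎
    where
    open ≡-Reasoning
    a b : ℕ → ℤ
    a m = freeWeight (suc n) m * φ m false
    b m = bondedWeight (suc n) m * φ m true
    b-last : b (suc (suc n)) ≡ + 0
    b-last = trans (cong (_* φ (suc (suc n)) true) (weights-vanish n)) (ℤP.*-zeroˡ (φ (suc (suc n)) true))
    pad : ∀ A B a₀ b₀ → a₀ ≡ + 0 → b₀ ≡ + 0 → A + B ≡ (a₀ + A) + (B + b₀)
    pad A B _ _ refl refl = cong₂ _+_ (sym (ℤP.+-identityˡ A)) (sym (ℤP.+-identityʳ B))
    regroup : ∀ F B c x y → F * (c * x - + 2 * y) + B * (c * x - + 1 * y) ≡ (F + B) * (c * x) + (- (+ 2 * F + B)) * y
    regroup = solve-∀
    reorder : ∀ h c x z → h * (c * x) + z ≡ c * h * x + z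
    reorder = solve-∀
    weights-suc : ∀ m → freeWeight n m * glue φ m false + bondedWeight n m * glue φ m true ≡ a (suc m) + b m
    weights-suc m = begin
      freeWeight n m * glue φ m false + bondedWeight n m * glue φ m true
        ≡⟨ regroup (freeWeight n m) (bondedWeight n m) (+ suc m) (φ (suc m) false) (φ m true) ⟩
      (freeWeight n m + bondedWeight n m) * (+ suc m * φ (suc m) false) + (- (+ 2 * freeWeight n m + bondedWeight n m)) * φ m true
        ≡⟨ cong₂ (λ u v → u * (+ suc m * φ (suc m) false) + v * φ m true) (freeWeight+bondedWeight n m) (sym (bondedWeight-suc n m)) ⟩
      summand m (suc n) * (+ suc m * φ (suc m) false) + b m
        ≡⟨ reorder (summand m (suc n)) (+ suc m) (φ (suc m) false) (b m) ⟩
      a (suc m) + b m ∎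

  signedSum≡blockSum : ∀ n φ → signedSum n φ ≡ blockSum n φ
  signedSum≡blockSum zero    φ = initial (φ 0 false) (φ 0 true) (φ 1 false) (φ 1 true)
    where
    initial : ∀ a b c d → + 1 * + 1 * c + + 0 ≡ (+ 0 * a + + 0 * b) + (+ 1 * c + + 0 * d)
    initial = solve-∀
  signedSum≡blockSum (suc n) φ = begin
    signedSum (suc n) φ   ≡⟨ signedSum-suc n φ ⟩
    signedSum n (glue φ)  ≡⟨ signedSum≡blockSum n (glue φ) ⟩
    blockSum n (glue φ)   ≡⟨ blockSum-glue n φ ⟩
    blockSum (suc n) φ    ∎
    where open ≡-Reasoning

  signedArrangements≡explicitSeries : ∀ n → sumBy (λ J → sign J * + arrangements J) (bondSets n) ≡ explicitSeries 0 (suc n)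
  signedArrangements≡explicitSeries n = begin
    sumBy (λ J → sign J * + arrangements J) (bondSets n)
      ≡⟨ sumBy-cong (bondSets n) (λ J → ℤP.*-identityʳ (sign J * + arrangements J)) ⟨
    signedSum n (λ _ _ → + 1)
      ≡⟨ signedSum≡blockSum n (λ _ _ → + 1) ⟩
    blockSum n (λ _ _ → + 1)
      ≡⟨ sumUpTo-cong (suc n) (λ m → trans (cong₂ _+_ (ℤP.*-identityʳ (freeWeight n m)) (ℤP.*-identityʳ (bondedWeight n m)))
                                           (freeWeight+bondedWeight n m)) ⟩
    sumUpTo (suc n) (λ m → summand m (suc n))
      ≡⟨ sumUpTo-cong (suc n) (λ j → cong (λ e → div1+t^ e (term j) (suc n)) (ℕP.+-identityʳ j)) ⟨
    explicitSeries 0 (suc n) ∎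
    where open ≡-Reasoning

module Permutations where

  open ListCounting
  open import Data.Nat as ℕ using (ℕ; zero; suc; _<_)
  import Data.Nat.Properties as ℕP
  open import Data.List using (List; []; _∷_; _++_; map; filter; length; concatMap)
  import Data.List.Properties as LP
  open import Data.List.Membership.Propositional using (_∈_; _∉_; find)
  open import Data.List.Membership.Propositional.Properties using (∈-map⁺; ∈-map⁻; ∈-concatMap⁺; ∈-concatMap⁻)
  open import Data.List.Membership.DecPropositional ℕP._≟_ using (_∈?_)
  open import Data.List.Relation.Unary.Any as Any using (Any; here; there)
  open import Data.List.Relation.Unary.All as All using (All; []; _∷_)
  import Data.List.Relation.Unary.All.Properties as All
  open import Data.List.Relation.Unary.Unique.Propositional using (Unique; []; _∷_)
  import Data.List.Relation.Unary.Unique.Propositional.Properties as Unique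
  open import Data.List.Relation.Binary.Permutation.Propositional using (_↭_; ↭⇒↭ₛ; ↭-sym)
  open import Data.List.Relation.Binary.Permutation.Propositional.Properties using (shift)
  import Data.List.Relation.Binary.Permutation.Setoid.Properties as ↭ₛ
  open import Data.Product using (_×_; _,_; ∃₂)
  open import Function using (_∘_)
  open import Relation.Nullary using (Dec; yes; no; ¬?; contradiction)
  open import Relation.Binary.Definitions using (_Respects_)
  open import Relation.Binary.PropositionalEquality

  Unique-resp-↭ : ∀ {A : Set} → Unique {A = A} Respects _↭_
  Unique-resp-↭ {A} p = ↭ₛ.Unique-resp-↭ (setoid A) (↭⇒↭ₛ p)

  Unique-moveToFront : ∀ {A : Set} {v : A} a {b} → Unique (a ++ v ∷ b) → Unique (v ∷ a ++ b)
  Unique-moveToFront {v = v} a {b} = Unique-resp-↭ (shift v a b)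

  Unique-moveFromFront : ∀ {A : Set} {v : A} a {b} → Unique (v ∷ a ++ b) → Unique (a ++ v ∷ b)
  Unique-moveFromFront {v = v} a {b} = Unique-resp-↭ (↭-sym (shift v a b))

  inserts : ℕ → List ℕ → List (List ℕ)
  inserts v []       = (v ∷ []) ∷ []
  inserts v (y ∷ ys) = (v ∷ y ∷ ys) ∷ map (y ∷_) (inserts v ys)

  -- the permutations of 0 … v - 1; the value i stands for i + 1
  perms : ℕ → List (List ℕ)
  perms zero    = [] ∷ []
  perms (suc v) = concatMap (inserts v) (perms v)

  record IsPerm (v : ℕ) (σ : List ℕ) : Set where
    constructor isPerm
    field
      unique  : Unique σ
      bounded : All (_< v) σ
      length≡ : length σ ≡ v

  ∈-inserts⁻ : ∀ {v} τ {σ} → σ ∈ inserts v τ → ∃₂ λ a b → τ ≡ a ++ b × σ ≡ a ++ v ∷ b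
  ∈-inserts⁻ []       (here refl) = [] , [] , refl , refl
  ∈-inserts⁻ (y ∷ ys) (here refl) = [] , y ∷ ys , refl , refl
  ∈-inserts⁻ (y ∷ ys) (there σ∈) with s , s∈ , refl ← ∈-map⁻ (y ∷_) σ∈ with a , b , refl , refl ← ∈-inserts⁻ ys s∈ =
    y ∷ a , b , refl , refl

  ∈-inserts⁺ : ∀ {v} a b → a ++ v ∷ b ∈ inserts v (a ++ b)
  ∈-inserts⁺ []      []      = here refl
  ∈-inserts⁺ []      (y ∷ b) = here refl
  ∈-inserts⁺ (x ∷ a) b       = there (∈-map⁺ (x ∷_) (∈-inserts⁺ a b))

  IsPerm-insert : ∀ {v} a {b} → IsPerm v (a ++ b) → IsPerm (suc v) (a ++ v ∷ b)
  IsPerm-insert {v} a {b} (isPerm u a++b<v len) = isPerm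
    (Unique-moveFromFront a (All.map ℕP.>⇒≢ a++b<v ∷ u))
    (All.++⁺ (All.map ℕP.m<n⇒m<1+n (All.++⁻ˡ a a++b<v)) (ℕP.n<1+n v ∷ All.map ℕP.m<n⇒m<1+n (All.++⁻ʳ a a++b<v)))
    (trans (LP.length-++-sucʳ a v b) (cong suc len))

  IsPerm-delete : ∀ {v} a {b} → IsPerm (suc v) (a ++ v ∷ b) → IsPerm v (a ++ b)
  IsPerm-delete {v} a {b} (isPerm u σ<1+v len) with v≢a++b ∷ u′ ← Unique-moveToFront a u = isPerm
    u′
    (All.zipWith (λ (x<1+v , v≢x) → ℕP.≤∧≢⇒< (ℕP.≤-pred x<1+v) (v≢x ∘ sym)) (a++b<1+v , v≢a++b))
    (ℕP.suc-injective (trans (sym (LP.length-++-sucʳ a v b)) len))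
    where
    a++b<1+v : All (_< suc v) (a ++ b)
    a++b<1+v = All.++⁺ (All.++⁻ˡ a σ<1+v) (All.tail (All.++⁻ʳ a σ<1+v))

  -- pigeonhole: without v, the v + 1 distinct entries would all lie below v
  IsPerm-max∈ : ∀ {v σ} → IsPerm (suc v) σ → v ∈ σ
  IsPerm-max∈ {v} {σ} (isPerm u σ<1+v len) with v ∈? σ
  ... | yes v∈σ = v∈σ
  ... | no  v∉σ = contradiction (length-unique-bounded u σ<v) (ℕP.<⇒≱ (ℕP.≤-reflexive (sym len)))
    where
    σ<v : All (_< v) σ
    σ<v = All.tabulate λ {x} x∈σ → ℕP.≤∧≢⇒< (ℕP.≤-pred (All.lookup σ<1+v x∈σ)) λ { refl → v∉σ x∈σ }

  ∈-split : ∀ {A : Set} {v : A} {σ} → v ∈ σ → ∃₂ λ a b → σ ≡ a ++ v ∷ b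
  ∈-split {σ = x ∷ σ} (here refl) = [] , σ , refl
  ∈-split {σ = x ∷ σ} (there v∈σ) with a , b , refl ← ∈-split v∈σ = x ∷ a , b , refl

  ∈-perms⁻ : ∀ v {σ} → σ ∈ perms v → IsPerm v σ
  ∈-perms⁻ zero    (here refl) = isPerm [] [] refl
  ∈-perms⁻ (suc v) σ∈ with τ , τ∈ , σ∈′ ← find (∈-concatMap⁻ (inserts v) {xs = perms v} σ∈)
                     with a , b , refl , refl ← ∈-inserts⁻ τ σ∈′ = IsPerm-insert a (∈-perms⁻ v τ∈)

  ∈-perms⁺ : ∀ v {σ} → IsPerm v σ → σ ∈ perms v
  ∈-perms⁺ zero    {[]} _ = here refl
  ∈-perms⁺ (suc v) {σ} p with a , b , refl ← ∈-split (IsPerm-max∈ p) =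
    ∈-concatMap⁺ (inserts v) (Any.map (λ { refl → ∈-inserts⁺ a b }) (∈-perms⁺ v (IsPerm-delete a p)))

  _≢?_ : ∀ (v x : ℕ) → Dec (v ≢ x)
  v ≢? x = ¬? (v ℕP.≟ x)

  removeAll : ℕ → List ℕ → List ℕ
  removeAll v = filter (v ≢?_)

  removeAll-inserted : ∀ {v} a {b} → v ∉ a ++ b → removeAll v (a ++ v ∷ b) ≡ a ++ b
  removeAll-inserted {v} a {b} v∉a++b = begin
    removeAll v (a ++ v ∷ b)              ≡⟨ LP.filter-++ (v ≢?_) a (v ∷ b) ⟩
    removeAll v a ++ removeAll v (v ∷ b)  ≡⟨ cong (removeAll v a ++_) (LP.filter-reject (v ≢?_) {v} {b} (λ v≢v → v≢v refl)) ⟩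
    removeAll v a ++ removeAll v b        ≡⟨ cong₂ _++_ (LP.filter-all (v ≢?_) (All.++⁻ˡ a v≢)) (LP.filter-all (v ≢?_) (All.++⁻ʳ a v≢)) ⟩
    a ++ b                                ∎
    where
    open ≡-Reasoning
    v≢ : All (v ≢_) (a ++ b)
    v≢ = All.tabulate λ { x∈ refl → v∉a++b x∈ }

  Unique-inserts : ∀ {v} τ → v ∉ τ → Unique (inserts v τ)
  Unique-inserts []       _   = [] ∷ []
  Unique-inserts {v} (y ∷ ys) v∉ = All.tabulate head≢ ∷ Unique.map⁺ LP.∷-injectiveʳ (Unique-inserts ys (v∉ ∘ there))
    where
    head≢ : ∀ {s} → s ∈ map (y ∷_) (inserts v ys) → v ∷ y ∷ ys ≢ s
    head≢ s∈ eq with _ , _ , refl ← ∈-map⁻ (y ∷_) s∈ = v∉ (here (LP.∷-injectiveˡ eq))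

  Unique-perms : ∀ v → Unique (perms v)
  Unique-perms zero    = [] ∷ []
  Unique-perms (suc v) = Unique-concatMap (inserts v) (Unique-perms v) (λ τ∈ → Unique-inserts _ (max∉ τ∈)) same-origin
    where
    max∉ : ∀ {τ} → τ ∈ perms v → v ∉ τ
    max∉ τ∈ v∈τ = ℕP.<-irrefl refl (All.lookup (IsPerm.bounded (∈-perms⁻ v τ∈)) v∈τ)
    same-origin : ∀ {x y z} → x ∈ perms v → y ∈ perms v → z ∈ inserts v x → z ∈ inserts v y → x ≡ y
    same-origin {x} {y} x∈ y∈ z∈x z∈y
      with a , b , refl , refl ← ∈-inserts⁻ x z∈x
      with a′ , b′ , refl , eq ← ∈-inserts⁻ y z∈y = begin
        a ++ b                    ≡⟨ removeAll-inserted a (max∉ x∈) ⟨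
        removeAll v (a ++ v ∷ b)   ≡⟨ cong (removeAll v) eq ⟩
        removeAll v (a′ ++ v ∷ b′) ≡⟨ removeAll-inserted a′ (max∉ y∈) ⟩
        a′ ++ b′                  ∎
      where open ≡-Reasoning

module BondProducts where

  open ListCounting
  open BondSets using (blocks; topBond; freeSides; arrangements)
  open Permutations
  open import Data.Nat as ℕ using (ℕ; suc; _<_; s≤s)
  import Data.Nat.Properties as ℕP
  open import Data.Integer as ℤ using (ℤ; +_; _-_; -_; _+_; _*_)
  import Data.Integer.Properties as ℤP
  open import Data.Integer.Tactic.RingSolver using (solve-∀)
  open import Data.Bool using (Bool; true; false)
  open import Data.Maybe using (Maybe; just; nothing)
  open import Data.Vec using (Vec; []; _∷_)
  open import Data.List using (List; []; _∷_; _++_; map; length; head; concatMap)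
  open import Data.List.Membership.Propositional using (_∈_; _∉_)
  open import Data.List.Relation.Unary.Any using (here; there)
  open import Data.List.Relation.Unary.All as All using (All; []; _∷_)
  import Data.List.Relation.Unary.All.Properties as All
  open import Data.List.Relation.Unary.Unique.Propositional using (Unique; _∷_)
  open import Data.Product using (_×_; _,_)
  open import Data.Sum using (_⊎_; inj₁; inj₂)
  open import Data.Empty using (⊥-elim)
  open import Function using (_∘_)
  open import Relation.Nullary using (Dec; yes; no; ¬_; _×-dec_; _⊎-dec_)
  open import Relation.Binary.PropositionalEquality

  open ℕP using (_≟_)

  δ : ℕ → ℕ → ℕ
  δ u x with u ≟ x
  ... | yes _ = 1
  ... | no  _ = 0

  δ-refl : ∀ u → δ u u ≡ 1
  δ-refl u with u ≟ u
  ... | yes _   = refl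
  ... | no  u≢u = ⊥-elim (u≢u refl)

  δ-≢ : ∀ {u x} → u ≢ x → δ u x ≡ 0
  δ-≢ {u} {x} u≢x with u ≟ x
  ... | yes u≡x = ⊥-elim (u≢x u≡x)
  ... | no  _   = refl

  multiplicity : ℕ → List ℕ → ℕ
  multiplicity u []       = 0
  multiplicity u (x ∷ xs) = δ u x ℕ.+ multiplicity u xs

  multiplicity-∉ : ∀ {u} xs → u ∉ xs → multiplicity u xs ≡ 0
  multiplicity-∉ []       _   = refl
  multiplicity-∉ (x ∷ xs) u∉ = cong₂ ℕ._+_ (δ-≢ (u∉ ∘ here)) (multiplicity-∉ xs (u∉ ∘ there))

  multiplicity-unique : ∀ {u xs} → Unique xs → u ∈ xs → multiplicity u xs ≡ 1
  multiplicity-unique {u} {x ∷ xs} (x∉ ∷ _) (here refl) =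
    cong₂ ℕ._+_ (δ-refl u) (multiplicity-∉ xs λ u∈ → All.lookup x∉ u∈ refl)
  multiplicity-unique {u} {x ∷ xs} (x∉ ∷ uxs) (there u∈) =
    trans (cong (ℕ._+ multiplicity u xs) (δ-≢ λ u≡x → All.lookup x∉ u∈ (sym u≡x))) (multiplicity-unique uxs u∈)

  Bond : ℕ → ℕ → ℕ → Set
  Bond j x y = (x ≡ j × y ≡ suc j) ⊎ (x ≡ suc j × y ≡ j)

  bond? : ∀ j x y → Dec (Bond j x y)
  bond? j x y = (x ≟ j ×-dec y ≟ suc j) ⊎-dec (x ≟ suc j ×-dec y ≟ j)

  isBond : ℕ → ℕ → ℕ → ℕ
  isBond j x y with bond? j x y
  ... | yes _ = 1
  ... | no  _ = 0

  isBond-¬ : ∀ {j x y} → ¬ Bond j x y → isBond j x y ≡ 0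
  isBond-¬ {j} {x} {y} ¬bond with bond? j x y
  ... | yes bond = ⊥-elim (¬bond bond)
  ... | no  _    = refl

  isBond-yes : ∀ {j x y} → Bond j x y → isBond j x y ≡ 1
  isBond-yes {j} {x} {y} bond with bond? j x y
  ... | yes _    = refl
  ... | no ¬bond = ⊥-elim (¬bond bond)

  -- A gap (l, r) of a list lies between neighbouring entries l and r; nothing marks an end of the list.
  gapBond : ℕ → Maybe ℕ → Maybe ℕ → ℕ
  gapBond j (just x) (just y) = isBond j x y
  gapBond j _        _        = 0

  gapBond-nothingʳ : ∀ j l → gapBond j l nothing ≡ 0
  gapBond-nothingʳ j nothing  = refl
  gapBond-nothingʳ j (just x) = refl

  -- p is the entry preceding the list, if any
  adjacenciesFrom : ℕ → Maybe ℕ → List ℕ → ℕ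
  adjacenciesFrom j p []      = 0
  adjacenciesFrom j p (x ∷ σ) = gapBond j p (just x) ℕ.+ adjacenciesFrom j (just x) σ

  adjacencies : ℕ → List ℕ → ℕ
  adjacencies j = adjacenciesFrom j nothing

  lastFrom : Maybe ℕ → List ℕ → Maybe ℕ
  lastFrom p []      = p
  lastFrom p (x ∷ a) = lastFrom (just x) a

  adjacenciesFrom-++ : ∀ j p a b → adjacenciesFrom j p (a ++ b) ≡ adjacenciesFrom j p a ℕ.+ adjacenciesFrom j (lastFrom p a) b
  adjacenciesFrom-++ j p []      b = refl
  adjacenciesFrom-++ j p (x ∷ a) b =
    trans (cong (gapBond j p (just x) ℕ.+_) (adjacenciesFrom-++ j (just x) a b)) (sym (ℕP.+-assoc (gapBond j p (just x)) _ _))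

  adjacenciesFrom-head : ∀ j p b → adjacenciesFrom j p b ≡ gapBond j p (head b) ℕ.+ adjacencies j b
  adjacenciesFrom-head j p []      = sym (trans (ℕP.+-identityʳ (gapBond j p nothing)) (gapBond-nothingʳ j p))
  adjacenciesFrom-head j p (x ∷ b) = refl

  sumGaps : (Maybe ℕ → Maybe ℕ → ℤ) → Maybe ℕ → List ℕ → ℤ
  sumGaps h p []       = h p nothing
  sumGaps h p (y ∷ ys) = h p (just y) + sumGaps h (just y) ys

  sumGaps-cong : ∀ {h h′} p τ → (∀ l r → h l r ≡ h′ l r) → sumGaps h p τ ≡ sumGaps h′ p τ
  sumGaps-cong p []      h≗h′ = h≗h′ p nothing
  sumGaps-cong p (y ∷ τ) h≗h′ = cong₂ _+_ (h≗h′ p (just y)) (sumGaps-cong (just y) τ h≗h′)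

  sumGaps-linear : ∀ a b h h′ p τ → sumGaps (λ l r → a * h l r + b * h′ l r) p τ ≡ a * sumGaps h p τ + b * sumGaps h′ p τ
  sumGaps-linear a b h h′ p []      = refl
  sumGaps-linear a b h h′ p (y ∷ τ) =
    trans (cong (_+_ (a * h p (just y) + b * h′ p (just y))) (sumGaps-linear a b h h′ (just y) τ))
          (distrib a b (h p (just y)) (h′ p (just y)) (sumGaps h (just y) τ) (sumGaps h′ (just y) τ))
    where
    distrib : ∀ a b x y u v → (a * x + b * y) + (a * u + b * v) ≡ a * (x + u) + b * (y + v)
    distrib = solve-∀

  sumGaps-*ʳ : ∀ h c p τ → sumGaps (λ l r → h l r * c) p τ ≡ c * sumGaps h p τ
  sumGaps-*ʳ h c p []      = ℤP.*-comm (h p nothing) c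
  sumGaps-*ʳ h c p (y ∷ τ) =
    trans (cong₂ _+_ (ℤP.*-comm (h p (just y)) c) (sumGaps-*ʳ h c (just y) τ)) (sym (ℤP.*-distribˡ-+ c (h p (just y)) _))

  sumGaps-const : ∀ c p τ → sumGaps (λ _ _ → c) p τ ≡ c * + suc (length τ)
  sumGaps-const c p []      = sym (ℤP.*-identityʳ c)
  sumGaps-const c p (y ∷ τ) =
    trans (cong (_+_ c) (sumGaps-const c (just y) τ)) (trans (factor c (+ suc (length τ))) (cong (c *_) (sym (ℤP.pos-+ 1 (suc (length τ))))))
    where
    factor : ∀ c n → c + c * n ≡ c * (+ 1 + n)
    factor = solve-∀

  sumGaps-gapBond : ∀ j p τ → sumGaps (λ l r → + gapBond j l r) p τ ≡ + adjacenciesFrom j p τ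
  sumGaps-gapBond j p []      = cong +_ (gapBond-nothingʳ j p)
  sumGaps-gapBond j p (y ∷ τ) =
    trans (cong (_+_ (+ gapBond j p (just y))) (sumGaps-gapBond j (just y) τ)) (sym (ℤP.pos-+ (gapBond j p (just y)) _))

  isValue : ℕ → Maybe ℕ → ℕ
  isValue n nothing  = 0
  isValue n (just x) = δ n x

  sumGaps-isValueˡ : ∀ n p τ → sumGaps (λ l r → + isValue n l) p τ ≡ + isValue n p + + multiplicity n τ
  sumGaps-isValueˡ n p []      = sym (ℤP.+-identityʳ _)
  sumGaps-isValueˡ n p (y ∷ τ) =
    cong (_+_ (+ isValue n p)) (trans (sumGaps-isValueˡ n (just y) τ) (sym (ℤP.pos-+ (δ n y) (multiplicity n τ))))

  sumGaps-isValueʳ : ∀ n p τ → sumGaps (λ l r → + isValue n r) p τ ≡ + multiplicity n τ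
  sumGaps-isValueʳ n p []      = refl
  sumGaps-isValueʳ n p (y ∷ τ) =
    trans (cong (_+_ (+ δ n y)) (sumGaps-isValueʳ n (just y) τ)) (sym (ℤP.pos-+ (δ n y) (multiplicity n τ)))

  sumBy-inserts : ∀ v p τ (g : List ℕ → ℤ) h →
                  (∀ a c → a ++ c ≡ τ → g (a ++ v ∷ c) ≡ h (lastFrom p a) (head c)) →
                  sumBy g (inserts v τ) ≡ sumGaps h p τ
  sumBy-inserts v p []      g h g≡h = trans (ℤP.+-identityʳ _) (g≡h [] [] refl)
  sumBy-inserts v p (y ∷ τ) g h g≡h = cong₂ _+_ (g≡h [] (y ∷ τ) refl) (begin
    sumBy g (map (y ∷_) (inserts v τ))       ≡⟨ sumBy-map g (y ∷_) (inserts v τ) ⟩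
    sumBy (g ∘ (y ∷_)) (inserts v τ)         ≡⟨ sumBy-inserts v (just y) τ (g ∘ (y ∷_)) h (λ a c eq → g≡h (y ∷ a) c (cong (y ∷_) eq)) ⟩
    sumGaps h (just y) τ                     ∎)
    where open ≡-Reasoning

  size : ∀ {n} → Vec Bool n → ℕ
  size []          = 0
  size (false ∷ J) = size J
  size (true ∷ J)  = suc (size J)

  bondProduct : ∀ {n} → Vec Bool n → List ℕ → ℤ
  bondProduct []               σ = + 1
  bondProduct (false ∷ J)      σ = bondProduct J σ
  bondProduct {suc n} (true ∷ J) σ = + adjacencies n σ * bondProduct J σ

  -- the bond product of τ once a value larger than n has been inserted into its gap (l, r)
  gapBondProduct : ∀ {n} → Vec Bool n → List ℕ → Maybe ℕ → Maybe ℕ → ℤ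
  gapBondProduct []                 τ l r = + 1
  gapBondProduct (false ∷ J)        τ l r = gapBondProduct J τ l r
  gapBondProduct {suc n} (true ∷ J) τ l r = (+ adjacencies n τ - + gapBond n l r) * gapBondProduct J τ l r

  lastEntry : List ℕ → Maybe ℕ
  lastEntry = lastFrom nothing

  gapBond-∉ʳ : ∀ {j v} l → v ≢ j → v ≢ suc j → gapBond j l (just v) ≡ 0
  gapBond-∉ʳ nothing  _   _    = refl
  gapBond-∉ʳ (just x) v≢j v≢1+j = isBond-¬ λ { (inj₁ (_ , v≡1+j)) → v≢1+j v≡1+j ; (inj₂ (_ , v≡j)) → v≢j v≡j }

  gapBond-∉ˡ : ∀ {j v} r → v ≢ j → v ≢ suc j → gapBond j (just v) r ≡ 0
  gapBond-∉ˡ nothing  _   _    = refl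
  gapBond-∉ˡ (just y) v≢j v≢1+j = isBond-¬ λ { (inj₁ (v≡j , _)) → v≢j v≡j ; (inj₂ (v≡1+j , _)) → v≢1+j v≡1+j }

  adjacencies-insert : ∀ j v a c → adjacencies j (a ++ v ∷ c) ≡
                       adjacencies j a ℕ.+ (gapBond j (lastEntry a) (just v) ℕ.+ (gapBond j (just v) (head c) ℕ.+ adjacencies j c))
  adjacencies-insert j v a c =
    trans (adjacenciesFrom-++ j nothing a (v ∷ c))
          (cong (λ k → adjacencies j a ℕ.+ (gapBond j (lastEntry a) (just v) ℕ.+ k)) (adjacenciesFrom-head j (just v) c))

  adjacencies-++ : ∀ j a c → adjacencies j (a ++ c) ≡ adjacencies j a ℕ.+ (gapBond j (lastEntry a) (head c) ℕ.+ adjacencies j c)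
  adjacencies-++ j a c = trans (adjacenciesFrom-++ j nothing a c) (cong (adjacencies j a ℕ.+_) (adjacenciesFrom-head j (lastEntry a) c))

  adjacencies-insert-unrelated : ∀ j v a c → v ≢ j → v ≢ suc j →
                                 adjacencies j (a ++ v ∷ c) ℕ.+ gapBond j (lastEntry a) (head c) ≡ adjacencies j (a ++ c)
  adjacencies-insert-unrelated j v a c v≢j v≢1+j
    rewrite adjacencies-insert j v a c | adjacencies-++ j a c
          | gapBond-∉ʳ (lastEntry a) v≢j v≢1+j | gapBond-∉ˡ (head c) v≢j v≢1+j =
    trans (ℕP.+-assoc (adjacencies j a) (adjacencies j c) _) (cong (adjacencies j a ℕ.+_) (ℕP.+-comm (adjacencies j c) _))

  [m+n]-n≡m : ∀ m n → + (m ℕ.+ n) - + n ≡ + m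
  [m+n]-n≡m m n = trans (cong (_- + n) (ℤP.pos-+ m n)) (cancel (+ m) (+ n))
    where
    cancel : ∀ a b → (a + b) - b ≡ a
    cancel = solve-∀

  bondProduct-insert-large : ∀ {n} (J : Vec Bool n) {v} a c → n < v →
                             bondProduct J (a ++ v ∷ c) ≡ gapBondProduct J (a ++ c) (lastEntry a) (head c)
  bondProduct-insert-large []          a c _   = refl
  bondProduct-insert-large (false ∷ J) a c n<v = bondProduct-insert-large J a c (ℕP.<-trans (ℕP.n<1+n _) n<v)
  bondProduct-insert-large {suc n} (true ∷ J) {v} a c 1+n<v =
    cong₂ _*_ broken (bondProduct-insert-large J a c (ℕP.<-trans (ℕP.n<1+n n) 1+n<v))
    where
    g = gapBond n (lastEntry a) (head c)
    broken : + adjacencies n (a ++ v ∷ c) ≡ + adjacencies n (a ++ c) - + g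
    broken = begin
      + adjacencies n (a ++ v ∷ c)                ≡⟨ [m+n]-n≡m (adjacencies n (a ++ v ∷ c)) g ⟨
      + (adjacencies n (a ++ v ∷ c) ℕ.+ g) - + g  ≡⟨ cong (λ k → + k - + g) (adjacencies-insert-unrelated n v a c v≢n v≢1+n) ⟩
      + adjacencies n (a ++ c) - + g              ∎
      where
      open ≡-Reasoning
      v≢n : v ≢ n
      v≢n refl = ℕP.<-asym (ℕP.n<1+n n) 1+n<v
      v≢1+n : v ≢ suc n
      v≢1+n refl = ℕP.<-irrefl refl 1+n<v

  adjacencies-≡0 : ∀ {n} w → All (_≢ suc n) w → adjacencies n w ≡ 0
  adjacencies-≡0 []          _                 = refl
  adjacencies-≡0 (x ∷ [])    _                 = refl
  adjacencies-≡0 (x ∷ y ∷ w) (x≢ ∷ y≢ ∷ w≢) =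
    cong₂ ℕ._+_ (isBond-¬ λ { (inj₁ (_ , y≡)) → y≢ y≡ ; (inj₂ (x≡ , _)) → x≢ x≡ }) (adjacencies-≡0 (y ∷ w) (y≢ ∷ w≢))

  gapBond-topʳ : ∀ n l → gapBond n l (just (suc n)) ≡ isValue n l
  gapBond-topʳ n nothing  = refl
  gapBond-topʳ n (just x) with bond? n x (suc n) | n ≟ x
  ... | yes (inj₁ _)          | yes _   = refl
  ... | yes (inj₁ (x≡n , _))  | no n≢x  = ⊥-elim (n≢x (sym x≡n))
  ... | yes (inj₂ (_ , 1+n≡n)) | _      = ⊥-elim (ℕP.1+n≢n 1+n≡n)
  ... | no ¬bond              | yes n≡x = ⊥-elim (¬bond (inj₁ (sym n≡x , refl)))
  ... | no _                  | no _    = refl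

  gapBond-topˡ : ∀ n r → gapBond n (just (suc n)) r ≡ isValue n r
  gapBond-topˡ n nothing  = refl
  gapBond-topˡ n (just y) with bond? n (suc n) y | n ≟ y
  ... | yes (inj₂ _)          | yes _   = refl
  ... | yes (inj₂ (_ , y≡n))  | no n≢y  = ⊥-elim (n≢y (sym y≡n))
  ... | yes (inj₁ (1+n≡n , _)) | _      = ⊥-elim (ℕP.1+n≢n 1+n≡n)
  ... | no ¬bond              | yes n≡y = ⊥-elim (¬bond (inj₂ (refl , sym n≡y)))
  ... | no _                  | no _    = refl

  beside : ℕ → Maybe ℕ → Maybe ℕ → ℕ
  beside n l r = isValue n l ℕ.+ isValue n r

  adjacencies-insert-top : ∀ n a c → All (_≢ suc n) a → All (_≢ suc n) c →
                           adjacencies n (a ++ suc n ∷ c) ≡ beside n (lastEntry a) (head c)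
  adjacencies-insert-top n a c a≢ c≢
    rewrite adjacencies-insert n (suc n) a c | adjacencies-≡0 a a≢ | adjacencies-≡0 c c≢
          | gapBond-topʳ n (lastEntry a) | gapBond-topˡ n (head c) =
    cong (isValue n (lastEntry a) ℕ.+_) (ℕP.+-identityʳ _)

  bondProduct-insert-top : ∀ n (J : Vec Bool n) a c → All (_≢ suc n) a → All (_≢ suc n) c →
    bondProduct (true ∷ J) (a ++ suc n ∷ c) ≡ + beside n (lastEntry a) (head c) * gapBondProduct J (a ++ c) (lastEntry a) (head c)
  bondProduct-insert-top n J a c a≢ c≢ =
    cong₂ _*_ (cong +_ (adjacencies-insert-top n a c a≢ c≢)) (bondProduct-insert-large J a c (ℕP.n<1+n n))

  Bond-unique : ∀ {i k x y} → Bond i x y → Bond k x y → i ≡ k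
  Bond-unique (inj₁ (refl , _))    (inj₁ (i≡k , _))       = i≡k
  Bond-unique (inj₂ (_ , refl))    (inj₂ (_ , i≡k))       = i≡k
  Bond-unique (inj₁ (refl , refl)) (inj₂ (refl , 1+i≡k))  = ⊥-elim (ℕP.m≢1+n+m _ {1} (sym 1+i≡k))
  Bond-unique (inj₂ (refl , refl)) (inj₁ (1+i≡k , refl))  = ⊥-elim (ℕP.m≢1+n+m _ {1} (sym 1+i≡k))

  isBond-disjoint : ∀ {i k} x y → i ≢ k → isBond k x y ℕ.* isBond i x y ≡ 0
  isBond-disjoint {i} {k} x y i≢k with bond? k x y | bond? i x y
  ... | no _       | _          = refl
  ... | yes _      | no _       = refl
  ... | yes bond-k | yes bond-i = ⊥-elim (i≢k (Bond-unique bond-i bond-k))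

  gapBond-disjoint : ∀ {i k} l r → i ≢ k → gapBond k l r ℕ.* gapBond i l r ≡ 0
  gapBond-disjoint nothing  r        _   = refl
  gapBond-disjoint (just x) nothing  _   = refl
  gapBond-disjoint (just x) (just y) i≢k = isBond-disjoint x y i≢k

  gapBondProduct-unbroken : ∀ {m} (J : Vec Bool m) τ (X : Maybe ℕ → Maybe ℕ → ℕ) →
    (∀ {j} l r → j < m → X l r ℕ.* gapBond j l r ≡ 0) →
    ∀ l r → + X l r * gapBondProduct J τ l r ≡ + X l r * bondProduct J τ
  gapBondProduct-unbroken []                 τ X X⊥ l r = refl
  gapBondProduct-unbroken {suc m} (false ∷ J) τ X X⊥ l r =
    gapBondProduct-unbroken J τ X (λ l r j<m → X⊥ l r (ℕP.m<n⇒m<1+n j<m)) l r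
  gapBondProduct-unbroken {suc m} (true ∷ J) τ X X⊥ l r = begin
    x * ((o - g) * P′)           ≡⟨ expand x g o P′ ⟩
    o * (x * P′) - (x * g) * P′  ≡⟨ cong₂ (λ u v → o * u - v * P′) rest x⊥g ⟩
    o * (x * P) - + 0 * P′       ≡⟨ collect x o P P′ ⟩
    x * (o * P)                  ∎
    where
    open ≡-Reasoning
    x = + X l r
    g = + gapBond m l r
    o = + adjacencies m τ
    P′ = gapBondProduct J τ l r
    P = bondProduct J τ
    x⊥g : x * g ≡ + 0
    x⊥g = trans (sym (ℤP.pos-* (X l r) (gapBond m l r))) (cong +_ (X⊥ l r (ℕP.n<1+n m)))
    rest : x * P′ ≡ x * P
    rest = gapBondProduct-unbroken J τ X (λ l r j<m → X⊥ l r (ℕP.m<n⇒m<1+n j<m)) l r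
    expand : ∀ x g o P′ → x * ((o - g) * P′) ≡ o * (x * P′) - (x * g) * P′
    expand = solve-∀
    collect : ∀ x o P P′ → o * (x * P) - + 0 * P′ ≡ x * (o * P)
    collect = solve-∀

  -- A gap is a bond {j, j + 1} for at most one j, so inserting into it breaks at most one
  -- of the counted adjacencies.
  sumGaps-gapBondProduct : ∀ {m} (J : Vec Bool m) τ →
                           sumGaps (gapBondProduct J τ) nothing τ ≡ bondProduct J τ * (+ suc (length τ) - + size J)
  sumGaps-gapBondProduct []          τ = trans (sumGaps-const (+ 1) nothing τ) (cong (+ 1 *_) (sym (ℤP.+-identityʳ (+ suc (length τ)))))
  sumGaps-gapBondProduct (false ∷ J) τ = sumGaps-gapBondProduct J τ
  sumGaps-gapBondProduct {suc m} (true ∷ J) τ = begin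
    sumGaps (λ l r → (o - + gapBond m l r) * gapBondProduct J τ l r) nothing τ
      ≡⟨ sumGaps-cong nothing τ split ⟩
    sumGaps (λ l r → o * gapBondProduct J τ l r + (- + 1) * (+ gapBond m l r * P)) nothing τ
      ≡⟨ sumGaps-linear o (- + 1) (gapBondProduct J τ) (λ l r → + gapBond m l r * P) nothing τ ⟩
    o * sumGaps (gapBondProduct J τ) nothing τ + (- + 1) * sumGaps (λ l r → + gapBond m l r * P) nothing τ
      ≡⟨ cong₂ (λ u v → o * u + (- + 1) * v) (sumGaps-gapBondProduct J τ)
               (trans (sumGaps-*ʳ (λ l r → + gapBond m l r) P nothing τ) (cong (P *_) (sumGaps-gapBond m nothing τ))) ⟩
    o * (P * (G - + size J)) + (- + 1) * (P * o)
      ≡⟨ collect o P G (+ size J) ⟩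
    o * P * (G - (+ 1 + + size J)) ∎
    where
    open ≡-Reasoning
    o = + adjacencies m τ
    G = + suc (length τ)
    P = bondProduct J τ
    collect : ∀ o P G s → o * (P * (G - s)) + (- + 1) * (P * o) ≡ o * P * (G - (+ 1 + s))
    collect = solve-∀
    distrib : ∀ o g P′ → (o - g) * P′ ≡ o * P′ + (- + 1) * (g * P′)
    distrib = solve-∀
    split : ∀ l r → (o - + gapBond m l r) * gapBondProduct J τ l r ≡ o * gapBondProduct J τ l r + (- + 1) * (+ gapBond m l r * P)
    split l r = trans (distrib o (+ gapBond m l r) (gapBondProduct J τ l r))
                      (cong (λ z → o * gapBondProduct J τ l r + (- + 1) * z)
                            (gapBondProduct-unbroken J τ (gapBond m) (λ l r j<m → gapBond-disjoint l r (ℕP.<⇒≢ j<m)) l r))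

  beside-gapBond-far : ∀ {n j} l r → suc j < n → beside n l r ℕ.* gapBond j l r ≡ 0
  beside-gapBond-far {n} nothing  r        _ = ℕP.*-zeroʳ (beside n nothing r)
  beside-gapBond-far {n} (just x) nothing  _ = ℕP.*-zeroʳ (beside n (just x) nothing)
  beside-gapBond-far {n} {j} (just x) (just y) 1+j<n with bond? j x y
  ... | no _                     = ℕP.*-zeroʳ (beside n (just x) (just y))
  ... | yes (inj₁ (refl , refl)) rewrite δ-≢ (ℕP.>⇒≢ (ℕP.<-trans (ℕP.n<1+n j) 1+j<n)) | δ-≢ (ℕP.>⇒≢ 1+j<n) = refl
  ... | yes (inj₂ (refl , refl)) rewrite δ-≢ (ℕP.>⇒≢ (ℕP.<-trans (ℕP.n<1+n j) 1+j<n)) | δ-≢ (ℕP.>⇒≢ 1+j<n) = refl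

  beside-gapBond-top : ∀ n l r → beside (suc n) l r ℕ.* gapBond n l r ≡ gapBond n l r
  beside-gapBond-top n nothing  r        = ℕP.*-zeroʳ (beside (suc n) nothing r)
  beside-gapBond-top n (just x) nothing  = ℕP.*-zeroʳ (beside (suc n) (just x) nothing)
  beside-gapBond-top n (just x) (just y) with bond? n x y
  ... | no _                     = ℕP.*-zeroʳ (beside (suc n) (just x) (just y))
  ... | yes (inj₁ (refl , refl)) rewrite δ-≢ (ℕP.1+n≢n {n}) | δ-refl (suc n) = refl
  ... | yes (inj₂ (refl , refl)) rewrite δ-≢ (ℕP.1+n≢n {n}) | δ-refl (suc n) = refl

  sumGaps-beside : ∀ n τ → sumGaps (λ l r → + beside n l r) nothing τ ≡ + 2 * + multiplicity n τ
  sumGaps-beside n τ = begin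
    sumGaps (λ l r → + beside n l r) nothing τ
      ≡⟨ sumGaps-cong nothing τ (λ l r → trans (ℤP.pos-+ (isValue n l) (isValue n r)) (ones (+ isValue n l) (+ isValue n r))) ⟩
    sumGaps (λ l r → + 1 * + isValue n l + + 1 * + isValue n r) nothing τ
      ≡⟨ sumGaps-linear (+ 1) (+ 1) (λ l r → + isValue n l) (λ l r → + isValue n r) nothing τ ⟩
    + 1 * sumGaps (λ l r → + isValue n l) nothing τ + + 1 * sumGaps (λ l r → + isValue n r) nothing τ
      ≡⟨ cong₂ (λ u v → + 1 * u + + 1 * v) (sumGaps-isValueˡ n nothing τ) (sumGaps-isValueʳ n nothing τ) ⟩
    + 1 * (+ 0 + + multiplicity n τ) + + 1 * + multiplicity n τ
      ≡⟨ double (+ multiplicity n τ) ⟩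
    + 2 * + multiplicity n τ ∎
    where
    open ≡-Reasoning
    ones : ∀ a b → a + b ≡ + 1 * a + + 1 * b
    ones = solve-∀
    double : ∀ c → + 1 * (+ 0 + c) + + 1 * c ≡ + 2 * c
    double = solve-∀

  sumGaps-beside-once : ∀ n τ P → multiplicity n τ ≡ 1 → sumGaps (λ l r → + beside n l r * P) nothing τ ≡ P * + 2
  sumGaps-beside-once n τ P once =
    trans (sumGaps-*ʳ (λ l r → + beside n l r) P nothing τ) (cong (P *_) (trans (sumGaps-beside n τ) (cong (λ k → + 2 * + k) once)))

  beside*gapBondProduct : ∀ n (J : Vec Bool n) τ l r →
    + beside (suc n) l r * ((+ adjacencies n τ - + gapBond n l r) * gapBondProduct J τ l r)
    ≡ + adjacencies n τ * (+ beside (suc n) l r * bondProduct J τ) + (- + 1) * (+ gapBond n l r * bondProduct J τ)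
  beside*gapBondProduct n J τ l r = begin
    b * ((o - g) * P′)                      ≡⟨ expand b g o P′ ⟩
    o * (b * P′) + (- + 1) * ((b * g) * P′) ≡⟨ cong₂ (λ u v → o * u + (- + 1) * (v * P′)) unbroken b*g≡g ⟩
    o * (b * P) + (- + 1) * (g * P′)        ≡⟨ cong (λ z → o * (b * P) + (- + 1) * z) unbrokenᵍ ⟩
    o * (b * P) + (- + 1) * (g * P)         ∎
    where
    open ≡-Reasoning
    b = + beside (suc n) l r
    g = + gapBond n l r
    o = + adjacencies n τ
    P′ = gapBondProduct J τ l r
    P = bondProduct J τ
    expand : ∀ b g o P′ → b * ((o - g) * P′) ≡ o * (b * P′) + (- + 1) * ((b * g) * P′)
    expand = solve-∀
    unbroken : b * P′ ≡ b * P
    unbroken = gapBondProduct-unbroken J τ (beside (suc n)) (λ l r j<n → beside-gapBond-far l r (s≤s j<n)) l r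
    b*g≡g : b * g ≡ g
    b*g≡g = trans (sym (ℤP.pos-* (beside (suc n) l r) (gapBond n l r))) (cong +_ (beside-gapBond-top n l r))
    unbrokenᵍ : g * P′ ≡ g * P
    unbrokenᵍ = gapBondProduct-unbroken J τ (gapBond n) (λ l r j<n → gapBond-disjoint l r (ℕP.<⇒≢ j<n)) l r

  sumGaps-beside-gapBondProduct : ∀ n (J : Vec Bool n) τ → multiplicity n τ ≡ 1 →
    sumGaps (λ l r → + beside n l r * gapBondProduct J τ l r) nothing τ ≡ + freeSides (topBond J) * bondProduct J τ
  sumGaps-beside-gapBondProduct n [] τ once = sumGaps-beside-once n τ (+ 1) once
  sumGaps-beside-gapBondProduct (suc n) (false ∷ J) τ once = begin
    sumGaps (λ l r → + beside (suc n) l r * gapBondProduct J τ l r) nothing τ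
      ≡⟨ sumGaps-cong nothing τ (gapBondProduct-unbroken J τ (beside (suc n)) (λ l r j<n → beside-gapBond-far l r (s≤s j<n))) ⟩
    sumGaps (λ l r → + beside (suc n) l r * bondProduct J τ) nothing τ
      ≡⟨ sumGaps-beside-once (suc n) τ (bondProduct J τ) once ⟩
    bondProduct J τ * + 2
      ≡⟨ ℤP.*-comm (bondProduct J τ) (+ 2) ⟩
    + 2 * bondProduct J τ ∎
    where open ≡-Reasoning
  sumGaps-beside-gapBondProduct (suc n) (true ∷ J) τ once = begin
    sumGaps (λ l r → + beside (suc n) l r * ((o - + gapBond n l r) * gapBondProduct J τ l r)) nothing τ
      ≡⟨ sumGaps-cong nothing τ (beside*gapBondProduct n J τ) ⟩
    sumGaps (λ l r → o * (+ beside (suc n) l r * P) + (- + 1) * (+ gapBond n l r * P)) nothing τ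
      ≡⟨ sumGaps-linear o (- + 1) (λ l r → + beside (suc n) l r * P) (λ l r → + gapBond n l r * P) nothing τ ⟩
    o * sumGaps (λ l r → + beside (suc n) l r * P) nothing τ + (- + 1) * sumGaps (λ l r → + gapBond n l r * P) nothing τ
      ≡⟨ cong₂ (λ u v → o * u + (- + 1) * v) (sumGaps-beside-once (suc n) τ P once)
               (trans (sumGaps-*ʳ (λ l r → + gapBond n l r) P nothing τ) (cong (P *_) (sumGaps-gapBond n nothing τ))) ⟩
    o * (P * + 2) + (- + 1) * (P * o)
      ≡⟨ collect o P ⟩
    + 1 * (o * P) ∎
    where
    open ≡-Reasoning
    o = + adjacencies n τ
    P = bondProduct J τ
    collect : ∀ o P → o * (P * + 2) + (- + 1) * (P * o) ≡ + 1 * (o * P)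
    collect = solve-∀

  insertionFactor : ∀ {n} → Bool → Vec Bool n → ℤ
  insertionFactor {n} false J = + suc (suc n) - + size J
  insertionFactor     true  J = + freeSides (topBond J)

  sumBy-inserts-bondProduct : ∀ n b (J : Vec Bool n) {τ} → IsPerm (suc n) τ →
    sumBy (bondProduct (b ∷ J)) (inserts (suc n) τ) ≡ insertionFactor b J * bondProduct J τ
  sumBy-inserts-bondProduct n false J {τ} (isPerm _ _ len) = begin
    sumBy (bondProduct J) (inserts (suc n) τ)
      ≡⟨ sumBy-inserts (suc n) nothing τ (bondProduct J) (gapBondProduct J τ) broken ⟩
    sumGaps (gapBondProduct J τ) nothing τ
      ≡⟨ sumGaps-gapBondProduct J τ ⟩
    bondProduct J τ * (+ suc (length τ) - + size J)
      ≡⟨ cong (λ k → bondProduct J τ * (+ suc k - + size J)) len ⟩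
    bondProduct J τ * insertionFactor false J
      ≡⟨ ℤP.*-comm (bondProduct J τ) _ ⟩
    insertionFactor false J * bondProduct J τ ∎
    where
    open ≡-Reasoning
    broken : ∀ a c → a ++ c ≡ τ → bondProduct J (a ++ suc n ∷ c) ≡ gapBondProduct J τ (lastEntry a) (head c)
    broken a c refl = bondProduct-insert-large J a c (ℕP.n<1+n n)
  sumBy-inserts-bondProduct n true J {τ} p@(isPerm u τ<1+n _) = begin
    sumBy (bondProduct (true ∷ J)) (inserts (suc n) τ)
      ≡⟨ sumBy-inserts (suc n) nothing τ _ (λ l r → + beside n l r * gapBondProduct J τ l r) glued ⟩
    sumGaps (λ l r → + beside n l r * gapBondProduct J τ l r) nothing τ
      ≡⟨ sumGaps-beside-gapBondProduct n J τ (multiplicity-unique u (IsPerm-max∈ p)) ⟩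
    + freeSides (topBond J) * bondProduct J τ ∎
    where
    open ≡-Reasoning
    glued : ∀ a c → a ++ c ≡ τ →
            bondProduct (true ∷ J) (a ++ suc n ∷ c) ≡ + beside n (lastEntry a) (head c) * gapBondProduct J τ (lastEntry a) (head c)
    glued a c refl = bondProduct-insert-top n J a c (All.map ℕP.<⇒≢ (All.++⁻ˡ a τ<1+n)) (All.map ℕP.<⇒≢ (All.++⁻ʳ a τ<1+n))

  weightedCount : ∀ {n} → Vec Bool n → ℤ
  weightedCount {n} J = sumBy (bondProduct J) (perms (suc n))

  weightedCount-∷ : ∀ {n} b (J : Vec Bool n) → weightedCount (b ∷ J) ≡ insertionFactor b J * weightedCount J
  weightedCount-∷ {n} b J = begin
    sumBy (bondProduct (b ∷ J)) (concatMap (inserts (suc n)) (perms (suc n)))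
      ≡⟨ sumBy-concatMap (bondProduct (b ∷ J)) (inserts (suc n)) (perms (suc n)) ⟩
    sumBy (λ τ → sumBy (bondProduct (b ∷ J)) (inserts (suc n) τ)) (perms (suc n))
      ≡⟨ sumBy-cong-∈ (perms (suc n)) (λ τ∈ → sumBy-inserts-bondProduct n b J (∈-perms⁻ (suc n) τ∈)) ⟩
    sumBy (λ τ → insertionFactor b J * bondProduct J τ) (perms (suc n))
      ≡⟨ sumBy-*ˡ (insertionFactor b J) (bondProduct J) (perms (suc n)) ⟩
    insertionFactor b J * weightedCount J ∎
    where open ≡-Reasoning

  blocks+size : ∀ {n} (J : Vec Bool n) → blocks J ℕ.+ size J ≡ suc n
  blocks+size []          = refl
  blocks+size (false ∷ J) = cong suc (blocks+size J)
  blocks+size (true ∷ J)  = trans (ℕP.+-suc (blocks J) (size J)) (cong suc (blocks+size J))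

  weightedCount≡arrangements : ∀ {n} (J : Vec Bool n) → weightedCount J ≡ + arrangements J
  weightedCount≡arrangements []          = refl
  weightedCount≡arrangements (false ∷ J) = begin
    weightedCount (false ∷ J)                   ≡⟨ weightedCount-∷ false J ⟩
    insertionFactor false J * weightedCount J   ≡⟨ cong₂ _*_ free-gaps (weightedCount≡arrangements J) ⟩
    + suc (blocks J) * + arrangements J         ≡⟨ ℤP.pos-* (suc (blocks J)) (arrangements J) ⟨
    + arrangements (false ∷ J)                  ∎
    where
    open ≡-Reasoning
    free-gaps : insertionFactor false J ≡ + suc (blocks J)
    free-gaps = trans (cong (λ k → + suc k - + size J) (sym (blocks+size J))) ([m+n]-n≡m (suc (blocks J)) (size J))
  weightedCount≡arrangements (true ∷ J) = begin
    weightedCount (true ∷ J)                          ≡⟨ weightedCount-∷ true J ⟩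
    + freeSides (topBond J) * weightedCount J         ≡⟨ cong (+ freeSides (topBond J) *_) (weightedCount≡arrangements J) ⟩
    + freeSides (topBond J) * + arrangements J        ≡⟨ ℤP.pos-* (freeSides (topBond J)) (arrangements J) ⟨
    + arrangements (true ∷ J)                         ∎
    where open ≡-Reasoning

module InclusionExclusion where

  open ListCounting
  open BondSets
  open Permutations
  open BondProducts
  open import Data.Nat as ℕ using (ℕ; zero; suc; _<_; _≤_; z≤n; s≤s; ∣_-_∣; _<?_)
  import Data.Nat.Properties as ℕP
  open import Data.Integer as ℤ using (ℤ; +_; _-_; -_; _+_; _*_)
  import Data.Integer.Properties as ℤP
  open import Data.Integer.Tactic.RingSolver using (solve-∀)
  open import Data.Bool using (true; false; if_then_else_)
  open import Data.Vec using ([]; _∷_)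
  open import Data.List using (List; []; _∷_; filter; length)
  open import Data.List.Membership.Propositional using (_∈_)
  open import Data.List.Relation.Unary.Any using (here; there)
  open import Data.List.Relation.Unary.All as All using (All; []; _∷_)
  open import Data.List.Relation.Unary.Unique.Propositional using (Unique; _∷_)
  open import Data.List.Relation.Unary.Linked using (Linked; []; [-]; _∷_; linked?)
  open import Data.Product using (_×_; _,_; ∃)
  open import Data.Sum using (inj₁; inj₂)
  open import Data.Empty using (⊥-elim)
  open import Relation.Nullary using (Dec; ¬_; yes; no; does)
  open import Relation.Binary.PropositionalEquality
  open import Function using (_∘_)

  Far : ℕ → ℕ → Set
  Far x y = 1 < ∣ x - y ∣

  King : List ℕ → Set
  King = Linked Far

  king? : ∀ σ → Dec (King σ)
  king? = linked? (λ x y → 1 <? ∣ x - y ∣)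

  ∣n-1+n∣≡1 : ∀ n → ∣ n - suc n ∣ ≡ 1
  ∣n-1+n∣≡1 zero    = refl
  ∣n-1+n∣≡1 (suc n) = ∣n-1+n∣≡1 n

  ¬Far-suc : ∀ x → ¬ Far x (suc x)
  ¬Far-suc x far = ℕP.<-irrefl (sym (∣n-1+n∣≡1 x)) far

  Bond⇒¬Far : ∀ {j x y} → Bond j x y → ¬ Far x y
  Bond⇒¬Far {j} (inj₁ (refl , refl)) = ¬Far-suc j
  Bond⇒¬Far {j} (inj₂ (refl , refl)) = ¬Far-suc j ∘ subst (1 <_) (ℕP.∣-∣-comm (suc j) j)

  ¬Far⇒Bond : ∀ {x y} → x ≢ y → ¬ Far x y → ∃ λ j → Bond j x y
  ¬Far⇒Bond {zero}        {zero}        x≢y _    = ⊥-elim (x≢y refl)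
  ¬Far⇒Bond {zero}        {suc zero}    _   _    = 0 , inj₁ (refl , refl)
  ¬Far⇒Bond {zero}        {suc (suc y)} _   near = ⊥-elim (near (s≤s (s≤s z≤n)))
  ¬Far⇒Bond {suc zero}    {zero}        _   _    = 0 , inj₂ (refl , refl)
  ¬Far⇒Bond {suc (suc x)} {zero}        _   near = ⊥-elim (near (s≤s (s≤s z≤n)))
  ¬Far⇒Bond {suc x}       {suc y}       x≢y near with j , bond ← ¬Far⇒Bond (x≢y ∘ cong suc) near = suc j , shift bond
    where
    shift : ∀ {j} → Bond j x y → Bond (suc j) (suc x) (suc y)
    shift (inj₁ (refl , refl)) = inj₁ (refl , refl)
    shift (inj₂ (refl , refl)) = inj₂ (refl , refl)

  adjacencies-King : ∀ j {σ} → King σ → adjacencies j σ ≡ 0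
  adjacencies-King j []                            = refl
  adjacencies-King j [-]                           = refl
  adjacencies-King j (far ∷ king) = cong₂ ℕ._+_ (isBond-¬ λ bond → Bond⇒¬Far bond far) (adjacencies-King j king)

  adjacencies-pos⇒∈ : ∀ j x σ → 0 < adjacencies j (x ∷ σ) → j ∈ x ∷ σ × suc j ∈ x ∷ σ
  adjacencies-pos⇒∈ j x (y ∷ r) pos with bond? j x y
  ... | yes (inj₁ (refl , refl)) = here refl , there (here refl)
  ... | yes (inj₂ (refl , refl)) = there (here refl) , here refl
  ... | no _ with j∈ , 1+j∈ ← adjacencies-pos⇒∈ j y r pos = there j∈ , there 1+j∈

  -- A second adjacent pair {j, j + 1} would repeat the entry of the first one.
  adjacencies≤1 : ∀ j {σ} → Unique σ → adjacencies j σ ≤ 1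
  adjacencies≤1 j {[]}        _               = z≤n
  adjacencies≤1 j {x ∷ []}    _               = z≤n
  adjacencies≤1 j {x ∷ y ∷ r} (x∉ ∷ unique) with bond? j x y
  ... | no _ = adjacencies≤1 j unique
  ... | yes bond with adjacencies j (y ∷ r) in eq
  ...   | zero  = s≤s z≤n
  ...   | suc _ with j∈ , 1+j∈ ← adjacencies-pos⇒∈ j y r (subst (0 <_) (sym eq) (s≤s z≤n)) =
    ⊥-elim (All.lookup x∉ (x∈ bond j∈ 1+j∈) refl)
    where
    x∈ : Bond j x y → j ∈ y ∷ r → suc j ∈ y ∷ r → x ∈ y ∷ r
    x∈ (inj₁ (refl , _)) j∈ _   = j∈
    x∈ (inj₂ (refl , _)) _  1+j∈ = 1+j∈

  ¬King⇒adjacency : ∀ {n σ} → Unique σ → All (_< suc n) σ → ¬ King σ → ∃ λ j → j < n × 0 < adjacencies j σ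
  ¬King⇒adjacency {σ = []}    _ _ ¬king = ⊥-elim (¬king [])
  ¬King⇒adjacency {σ = x ∷ []} _ _ ¬king = ⊥-elim (¬king [-])
  ¬King⇒adjacency {n} {x ∷ y ∷ r} (x∉ ∷ unique) (x<1+n ∷ y<1+n ∷ r<1+n) ¬king with 1 <? ∣ x - y ∣
  ... | yes far with j , j<n , pos ← ¬King⇒adjacency unique (y<1+n ∷ r<1+n) (¬king ∘ (far ∷_)) =
    j , j<n , ℕP.<-≤-trans pos (ℕP.m≤n+m _ (isBond j x y))
  ... | no near with j , bond ← ¬Far⇒Bond (All.head x∉) near =
    j , bound bond , subst (λ k → 0 < k ℕ.+ adjacencies j (y ∷ r)) (sym (isBond-yes bond)) (s≤s z≤n)
    where
    bound : Bond j x y → j < n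
    bound (inj₁ (_ , refl)) = ℕP.≤-pred y<1+n
    bound (inj₂ (refl , _)) = ℕP.≤-pred x<1+n

  noAdjacency : ℕ → List ℕ → ℤ
  noAdjacency zero    σ = + 1
  noAdjacency (suc n) σ = (+ 1 - + adjacencies n σ) * noAdjacency n σ

  noAdjacency-King : ∀ n {σ} → King σ → noAdjacency n σ ≡ + 1
  noAdjacency-King zero    king = refl
  noAdjacency-King (suc n) king rewrite adjacencies-King n king | noAdjacency-King n king = refl

  noAdjacency-adjacent : ∀ {n j σ} → j < n → adjacencies j σ ≡ 1 → noAdjacency n σ ≡ + 0
  noAdjacency-adjacent {suc n} {j} {σ} j<1+n once with ℕP.m≤n⇒m<n∨m≡n (ℕP.≤-pred j<1+n)
  ... | inj₁ j<n  = trans (cong ((+ 1 - + adjacencies n σ) *_) (noAdjacency-adjacent j<n once)) (ℤP.*-zeroʳ (+ 1 - + adjacencies n σ))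
  ... | inj₂ refl rewrite once = refl

  noAdjacency-perm : ∀ n {σ} → IsPerm (suc n) σ → noAdjacency n σ ≡ (if does (king? σ) then + 1 else + 0)
  noAdjacency-perm n {σ} (isPerm unique bounded _) with king? σ
  ... | yes king = noAdjacency-King n king
  ... | no ¬king with j , j<n , pos ← ¬King⇒adjacency unique bounded ¬king =
    noAdjacency-adjacent j<n (ℕP.≤-antisym (adjacencies≤1 j unique) pos)

  sumBy-sign*bondProduct : ∀ n σ → sumBy (λ J → sign J * bondProduct J σ) (bondSets n) ≡ noAdjacency n σ
  sumBy-sign*bondProduct zero    σ = refl
  sumBy-sign*bondProduct (suc n) σ = begin
    sumBy (λ J → sign J * bondProduct J σ) (bondSets (suc n))
      ≡⟨ sumBy-concatMap (λ J → sign J * bondProduct J σ) (λ J → (false ∷ J) ∷ (true ∷ J) ∷ []) (bondSets n) ⟩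
    sumBy (λ J → sign J * bondProduct J σ + ((- sign J) * (a * bondProduct J σ) + + 0)) (bondSets n)
      ≡⟨ sumBy-cong (bondSets n) (λ J → factor (sign J) (bondProduct J σ) a) ⟩
    sumBy (λ J → (+ 1 - a) * (sign J * bondProduct J σ)) (bondSets n)
      ≡⟨ sumBy-*ˡ (+ 1 - a) (λ J → sign J * bondProduct J σ) (bondSets n) ⟩
    (+ 1 - a) * sumBy (λ J → sign J * bondProduct J σ) (bondSets n)
      ≡⟨ cong ((+ 1 - a) *_) (sumBy-sign*bondProduct n σ) ⟩
    noAdjacency (suc n) σ ∎
    where
    open ≡-Reasoning
    a = + adjacencies n σ
    factor : ∀ s P a → s * P + ((- s) * (a * P) + + 0) ≡ (+ 1 - a) * (s * P)
    factor = solve-∀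

  kings≡explicitSeries : ∀ n → + length (filter king? (perms (suc n))) ≡ explicitSeries 0 (suc n)
  kings≡explicitSeries n = begin
    + length (filter king? (perms (suc n)))
      ≡⟨ length-filter≡sumBy king? (perms (suc n)) ⟩
    sumBy (λ σ → if does (king? σ) then + 1 else + 0) (perms (suc n))
      ≡⟨ sumBy-cong-∈ (perms (suc n)) (λ σ∈ → trans (sym (noAdjacency-perm n (∈-perms⁻ (suc n) σ∈))) (sym (sumBy-sign*bondProduct n _))) ⟩
    sumBy (λ σ → sumBy (λ J → sign J * bondProduct J σ) (bondSets n)) (perms (suc n))
      ≡⟨ sumBy-comm (λ σ J → sign J * bondProduct J σ) (perms (suc n)) (bondSets n) ⟩
    sumBy (λ J → sumBy (λ σ → sign J * bondProduct J σ) (perms (suc n))) (bondSets n)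
      ≡⟨ sumBy-cong (bondSets n) (λ J → trans (sumBy-*ˡ (sign J) (bondProduct J) (perms (suc n))) (cong (sign J *_) (weightedCount≡arrangements J))) ⟩
    sumBy (λ J → sign J * + arrangements J) (bondSets n)
      ≡⟨ signedArrangements≡explicitSeries n ⟩
    explicitSeries 0 (suc n) ∎
    where open ≡-Reasoning

module FinWords where

  open ListCounting
  open Permutations
  open InclusionExclusion using (King; king?)
  open import Data.Nat as ℕ using (ℕ; zero; suc; _<_; _∸_)
  import Data.Nat.Properties as ℕP
  open import Data.Fin using (Fin; toℕ; fromℕ<)
  import Data.Fin.Properties as FinP
  open import Data.Maybe using (just)
  open import Data.List using (List; []; _∷_; map; filter; length; head; last; allFin)
  import Data.List.Properties as LP
  open import Data.List.Membership.Propositional using (_∈_; find)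
  open import Data.List.Membership.Propositional.Properties using (∈-map⁺; ∈-map⁻; ∈-allFin; ∈-concatMap⁺; ∈-concatMap⁻)
  open import Data.List.Relation.Unary.Any as Any using (here)
  open import Data.List.Relation.Unary.All as All using (All; []; _∷_)
  import Data.List.Relation.Unary.Linked.Properties as Linked
  open import Data.List.Relation.Unary.Unique.Propositional using (Unique; []; _∷_)
  import Data.List.Relation.Unary.Unique.Propositional.Properties as Unique
  open import Data.Product using (_×_; _,_; ∃)
  open import Function using (_∘_; _⇔_; mk⇔; Equivalence)
  open import Relation.Unary using (Decidable)
  open import Relation.Unary.Properties using (_∩?_; ∁?)
  open import Relation.Nullary using (¬_; ¬?)
  import Data.Maybe.Properties as MaybeP
  open import Relation.Binary.PropositionalEquality

  words-length : ∀ k n {w} → w ∈ words k n → length w ≡ n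
  words-length k zero    (here refl) = refl
  words-length k (suc n) w∈ with x , _ , w∈′ ← find (∈-concatMap⁻ (λ x → map (x ∷_) (words k n)) {xs = allFin k} w∈)
                            with w′ , w′∈ , refl ← ∈-map⁻ (x ∷_) w∈′ = cong suc (words-length k n w′∈)

  words-complete : ∀ k n w → length w ≡ n → w ∈ words k n
  words-complete k zero    []      refl = here refl
  words-complete k (suc n) (x ∷ w) len =
    ∈-concatMap⁺ (λ x → map (x ∷_) (words k n))
      (Any.map (λ { refl → ∈-map⁺ (x ∷_) (words-complete k n w (ℕP.suc-injective len)) }) (∈-allFin x))

  words-unique : ∀ k n → Unique (words k n)
  words-unique k zero    = [] ∷ []
  words-unique k (suc n) =
    Unique-concatMap (λ x → map (x ∷_) (words k n)) (Unique.allFin⁺ k) (λ _ → Unique.map⁺ LP.∷-injectiveʳ (words-unique k n)) same-head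
    where
    same-head : ∀ {x y z} → x ∈ allFin k → y ∈ allFin k → z ∈ map (x ∷_) (words k n) → z ∈ map (y ∷_) (words k n) → x ≡ y
    same-head _ _ z∈x z∈y with _ , _ , refl ← ∈-map⁻ (_ ∷_) z∈x with _ , _ , refl ← ∈-map⁻ (_ ∷_) z∈y = refl

  toℕ-all< : ∀ {n} (a : List (Fin n)) → All (_< n) (map toℕ a)
  toℕ-all< []      = []
  toℕ-all< (x ∷ a) = FinP.toℕ<n x ∷ toℕ-all< a

  fromℕ<-list : ∀ {n σ} → All (_< n) σ → ∃ λ (a : List (Fin n)) → map toℕ a ≡ σ
  fromℕ<-list []            = [] , refl
  fromℕ<-list (x<n ∷ σ<n) with a , refl ← fromℕ<-list σ<n = fromℕ< x<n ∷ a , cong (_∷ map toℕ a) (FinP.toℕ-fromℕ< x<n)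

  length-filter-words≡perms : ∀ n {P : List (Fin n) → Set} {Q : List ℕ → Set} (P? : Decidable P) (Q? : Decidable Q) →
    (∀ a → P a ⇔ (Unique a × Q (map toℕ a))) →
    length (filter P? (words n n)) ≡ length (filter Q? (perms n))
  length-filter-words≡perms n {P} {Q} P? Q? P⇔Q = length-filter-bijection P? Q? (map toℕ) (LP.map-injective FinP.toℕ-injective)
    (words-unique n n) (Unique-perms n) to from
    where
    to : ∀ {a} → a ∈ words n n → P a → map toℕ a ∈ perms n × Q (map toℕ a)
    to {a} a∈ Pa with unique , Qa ← Equivalence.to (P⇔Q a) Pa =
      ∈-perms⁺ n (isPerm (Unique.map⁺ FinP.toℕ-injective unique) (toℕ-all< a) (trans (LP.length-map toℕ a) (words-length n n a∈))) , Qa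
    from : ∀ {σ} → σ ∈ perms n → Q σ → ∃ λ a → a ∈ words n n × P a × map toℕ a ≡ σ
    from σ∈ Qσ with isPerm unique σ<n len ← ∈-perms⁻ n σ∈ with a , refl ← fromℕ<-list σ<n =
      a , words-complete n n a (trans (sym (LP.length-map toℕ a)) len) , Equivalence.from (P⇔Q a) (Unique.map⁻ unique , Qσ) , refl

  StartsWith0 : List ℕ → Set
  StartsWith0 σ = head σ ≡ just 0

  EndsWith : ℕ → List ℕ → Set
  EndsWith v σ = last σ ≡ just v

  startsWith0? : Decidable StartsWith0
  startsWith0? σ = MaybeP.≡-dec ℕP._≟_ (head σ) (just 0)

  endsWith? : ∀ v → Decidable (EndsWith v)
  endsWith? v σ = MaybeP.≡-dec ℕP._≟_ (last σ) (just v)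

  KingB : List ℕ → Set
  KingB σ = King σ × ¬ StartsWith0 σ

  KingC : ℕ → List ℕ → Set
  KingC v σ = KingB σ × ¬ EndsWith v σ

  kingB? : Decidable KingB
  kingB? = king? ∩? ∁? startsWith0?

  kingC? : ∀ v → Decidable (KingC v)
  kingC? v = kingB? ∩? ∁? (endsWith? v)

  BeginsWithOne⇔StartsWith0 : ∀ {n} (a : List (Fin n)) → BeginsWithOne a ⇔ StartsWith0 (map toℕ a)
  BeginsWithOne⇔StartsWith0 []      = mk⇔ (λ ()) (λ ())
  BeginsWithOne⇔StartsWith0 (x ∷ a) = mk⇔ (cong just) MaybeP.just-injective

  EndsWithMax⇔EndsWith : ∀ {n} (a : List (Fin n)) → EndsWithMax a ⇔ EndsWith (n ∸ 1) (map toℕ a)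
  EndsWithMax⇔EndsWith []          = mk⇔ (λ ()) (λ ())
  EndsWithMax⇔EndsWith (x ∷ [])    = mk⇔ (cong just) MaybeP.just-injective
  EndsWithMax⇔EndsWith (x ∷ y ∷ a) = EndsWithMax⇔EndsWith (y ∷ a)

  Acount-perms : ∀ n → Acount n ≡ length (filter king? (perms n))
  Acount-perms n = length-filter-words≡perms n isKing? king? λ a → mk⇔
    (λ (unique , linked) → unique , Linked.map⁺ linked)
    (λ (unique , king) → unique , Linked.map⁻ king)

  Bcount-perms : ∀ n → Bcount n ≡ length (filter kingB? (perms n))
  Bcount-perms n = trans (cong length (filter-filter (¬? ∘ beginsWithOne?) isKing? (words n n)))
    (length-filter-words≡perms n _ kingB? λ a → let open Equivalence (BeginsWithOne⇔StartsWith0 a) in mk⇔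
      (λ ((unique , linked) , ¬begins) → unique , Linked.map⁺ linked , ¬begins ∘ from)
      (λ (unique , king , ¬starts) → (unique , Linked.map⁻ king) , ¬starts ∘ to))

  Ccount-perms : ∀ n → Ccount n ≡ length (filter (kingC? (n ∸ 1)) (perms n))
  Ccount-perms n = trans (cong length (trans (filter-filter (¬? ∘ endsWithMax?) (¬? ∘ beginsWithOne?) (K n))
                                        (filter-filter _ isKing? (words n n))))
    (length-filter-words≡perms n _ (kingC? (n ∸ 1)) λ a →
      let module B = Equivalence (BeginsWithOne⇔StartsWith0 a)
          module E = Equivalence (EndsWithMax⇔EndsWith a) in mk⇔
      (λ ((unique , linked) , ¬begins , ¬ends) → unique , (Linked.map⁺ linked , ¬begins ∘ B.from) , ¬ends ∘ E.from)
      (λ (unique , (king , ¬starts) , ¬ends) → (unique , Linked.map⁻ king) , ¬starts ∘ B.to , ¬ends ∘ E.to))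

module Bijections where

  open ListCounting
  open Permutations
  open InclusionExclusion using (Far; King; king?; ¬Far-suc)
  open FinWords
  open import Data.Nat as ℕ using (ℕ; zero; suc; _<_; z≤n; s≤s)
  import Data.Nat.Properties as ℕP
  open import Data.Maybe using (just)
  import Data.Maybe.Properties as MaybeP
  open import Data.Maybe.Relation.Binary.Connected using (Connected; just; nothing-just)
  open import Data.List using (List; []; _∷_; _∷ʳ_; map; filter; length; last; initLast; _∷ʳ′_)
  import Data.List.Properties as LP
  open import Data.List.Membership.Propositional using (_∈_)
  open import Data.List.Relation.Unary.Any using (here; there)
  open import Data.List.Relation.Unary.All as All using (All; []; _∷_)
  import Data.List.Relation.Unary.All.Properties as All
  open import Data.List.Relation.Unary.Linked using (Linked; []; [-]; _∷_)
  import Data.List.Relation.Unary.Linked.Properties as Linked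
  open import Data.List.Relation.Unary.Unique.Propositional using (Unique; _∷_)
  import Data.List.Relation.Unary.Unique.Propositional.Properties as Unique
  open import Data.Product using (_×_; _,_; ∃)
  open import Data.Empty using (⊥-elim)
  open import Relation.Nullary using (¬_)
  open import Relation.Unary.Properties using (_∩?_)
  open import Relation.Binary.PropositionalEquality

  Far-< : ∀ {x y} → suc x < y → Far x y
  Far-< {zero}  {suc zero}    (s≤s ())
  Far-< {zero}  {suc (suc y)} _         = s≤s (s≤s z≤n)
  Far-< {suc x} {suc y}       (s≤s 1+x<y) = Far-< 1+x<y

  IsPerm-0∷suc : ∀ {v τ} → IsPerm v τ → IsPerm (suc v) (0 ∷ map suc τ)
  IsPerm-0∷suc {v} {τ} (isPerm unique τ<v len) = isPerm
    (All.map⁺ (All.universal (λ _ ()) τ) ∷ Unique.map⁺ ℕP.suc-injective unique)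
    (s≤s z≤n ∷ All.map⁺ (All.map s≤s τ<v))
    (cong suc (trans (LP.length-map suc τ) len))

  positive⇒map-suc : ∀ ρ → All (0 ≢_) ρ → ∃ λ τ → ρ ≡ map suc τ
  positive⇒map-suc []          []        = [] , refl
  positive⇒map-suc (zero ∷ ρ)  (0≢0 ∷ _) = ⊥-elim (0≢0 refl)
  positive⇒map-suc (suc x ∷ ρ) (_ ∷ 0∉ρ) with τ , refl ← positive⇒map-suc ρ 0∉ρ = x ∷ τ , refl

  IsPerm-0∷suc⁻ : ∀ {v ρ} → IsPerm (suc v) (0 ∷ ρ) → ∃ λ τ → ρ ≡ map suc τ × IsPerm v τ
  IsPerm-0∷suc⁻ {v} {ρ} (isPerm (0∉ρ ∷ unique) (_ ∷ ρ<1+v) len) with τ , refl ← positive⇒map-suc ρ 0∉ρ = τ , refl , isPerm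
    (Unique.map⁻ unique)
    (All.map ℕP.≤-pred (All.map⁻ ρ<1+v))
    (trans (sym (LP.length-map suc τ)) (ℕP.suc-injective len))

  King-0∷suc : ∀ {τ} → KingB τ → King (0 ∷ map suc τ)
  King-0∷suc {[]}         _               = [-]
  King-0∷suc {zero ∷ τ}   (_ , ¬starts)   = ⊥-elim (¬starts refl)
  King-0∷suc {suc x ∷ τ}  (king , _)      = Far-< (s≤s (s≤s z≤n)) ∷ Linked.map⁺ king

  King-0∷suc⁻ : ∀ {τ} → King (0 ∷ map suc τ) → KingB τ
  King-0∷suc⁻ {[]}        _             = [] , λ ()
  King-0∷suc⁻ {zero ∷ τ}  (far ∷ _)     = ⊥-elim (¬Far-suc 0 far)
  King-0∷suc⁻ {suc x ∷ τ} (_ ∷ king)    = Linked.map⁻ king , λ ()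

  startingWith0≡kingB : ∀ v → length (filter (king? ∩? startsWith0?) (perms (suc v))) ≡ length (filter kingB? (perms v))
  startingWith0≡kingB v = sym (length-filter-bijection kingB? (king? ∩? startsWith0?) (λ τ → 0 ∷ map suc τ)
    (λ eq → LP.map-injective ℕP.suc-injective (LP.∷-injectiveʳ eq)) (Unique-perms v) (Unique-perms (suc v)) to from)
    where
    to : ∀ {τ} → τ ∈ perms v → KingB τ → 0 ∷ map suc τ ∈ perms (suc v) × (King (0 ∷ map suc τ) × StartsWith0 (0 ∷ map suc τ))
    to τ∈ kingB = ∈-perms⁺ (suc v) (IsPerm-0∷suc (∈-perms⁻ v τ∈)) , King-0∷suc kingB , refl
    from : ∀ {σ} → σ ∈ perms (suc v) → King σ × StartsWith0 σ → ∃ λ τ → τ ∈ perms v × KingB τ × 0 ∷ map suc τ ≡ σ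
    from {zero ∷ ρ} σ∈ (king , refl) with τ , refl , perm ← IsPerm-0∷suc⁻ (∈-perms⁻ (suc v) σ∈) =
      τ , ∈-perms⁺ v perm , King-0∷suc⁻ king , refl

  last-∷ʳ : ∀ (xs : List ℕ) x → last (xs ∷ʳ x) ≡ just x
  last-∷ʳ []          x = refl
  last-∷ʳ (y ∷ [])    x = refl
  last-∷ʳ (y ∷ z ∷ r) x = last-∷ʳ (z ∷ r) x

  last-∈ : ∀ {xs : List ℕ} {x} → last xs ≡ just x → x ∈ xs
  last-∈ {y ∷ []}    refl = here refl
  last-∈ {y ∷ z ∷ r} eq   = there (last-∈ {z ∷ r} eq)

  Linked-∷ʳ⁻ : ∀ {xs : List ℕ} {y} → Linked Far (xs ∷ʳ y) → Linked Far xs × Connected Far (last xs) (just y)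
  Linked-∷ʳ⁻ {[]}        _             = [] , nothing-just
  Linked-∷ʳ⁻ {x ∷ []}    (far ∷ _)     = [-] , just far
  Linked-∷ʳ⁻ {x ∷ z ∷ r} (far ∷ rest) with linked , connected ← Linked-∷ʳ⁻ {z ∷ r} rest = far ∷ linked , connected

  IsPerm-∷ʳ : ∀ {v τ} → IsPerm v τ → IsPerm (suc v) (τ ∷ʳ v)
  IsPerm-∷ʳ {v} {τ} perm = IsPerm-insert τ (subst (IsPerm v) (sym (LP.++-identityʳ τ)) perm)

  IsPerm-∷ʳ⁻ : ∀ {v τ} → IsPerm (suc v) (τ ∷ʳ v) → IsPerm v τ
  IsPerm-∷ʳ⁻ {v} {τ} perm = subst (IsPerm v) (LP.++-identityʳ τ) (IsPerm-delete τ perm)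

  last-∷ : ∀ (y : ℕ) τ → ∃ λ l → last (y ∷ τ) ≡ just l
  last-∷ y []      = y , refl
  last-∷ y (z ∷ τ) = last-∷ z τ

  King-∷ʳ : ∀ {w} y τ → All (_< suc w) (y ∷ τ) → KingC w (y ∷ τ) → KingB ((y ∷ τ) ∷ʳ suc w)
  King-∷ʳ {w} y τ bounded ((king , ¬starts) , ¬ends) with l , eq ← last-∷ y τ =
    Linked.++⁺ king (subst (λ m → Connected Far m (just (suc w))) (sym eq) (just far)) [-] , ¬starts
    where
    far : Far l (suc w)
    far = Far-< (s≤s (ℕP.≤∧≢⇒< (ℕP.≤-pred (All.lookup bounded (last-∈ eq))) λ { refl → ¬ends eq }))

  King-∷ʳ⁻ : ∀ {w} y τ → KingB ((y ∷ τ) ∷ʳ suc w) → KingC w (y ∷ τ)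
  King-∷ʳ⁻ {w} y τ (king , ¬starts) with linked , connected ← Linked-∷ʳ⁻ king = (linked , ¬starts) , ¬ends connected
    where
    ¬ends : Connected Far (last (y ∷ τ)) (just (suc w)) → ¬ EndsWith w (y ∷ τ)
    ¬ends connected eq with just far ← subst (λ m → Connected Far m (just (suc w))) eq connected = ¬Far-suc w far

  endingWithMax≡kingC : ∀ w → length (filter (kingB? ∩? endsWith? (suc w)) (perms (suc (suc w)))) ≡ length (filter (kingC? w) (perms (suc w)))
  endingWithMax≡kingC w = sym (length-filter-bijection (kingC? w) (kingB? ∩? endsWith? (suc w)) (_∷ʳ suc w)
    (LP.∷ʳ-injectiveˡ _ _) (Unique-perms (suc w)) (Unique-perms (suc (suc w))) to from)
    where
    to : ∀ {τ} → τ ∈ perms (suc w) → KingC w τ →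
         τ ∷ʳ suc w ∈ perms (suc (suc w)) × (KingB (τ ∷ʳ suc w) × EndsWith (suc w) (τ ∷ʳ suc w))
    to {τ} τ∈ kingC = appended τ (∈-perms⁻ (suc w) τ∈) kingC
      where
      appended : ∀ τ → IsPerm (suc w) τ → KingC w τ →
                 τ ∷ʳ suc w ∈ perms (suc (suc w)) × (KingB (τ ∷ʳ suc w) × EndsWith (suc w) (τ ∷ʳ suc w))
      appended []      (isPerm _ _ ()) _
      appended (y ∷ τ) perm            kingC =
        ∈-perms⁺ (suc (suc w)) (IsPerm-∷ʳ perm) , King-∷ʳ y τ (IsPerm.bounded perm) kingC , last-∷ʳ (y ∷ τ) (suc w)
    from : ∀ {σ} → σ ∈ perms (suc (suc w)) → KingB σ × EndsWith (suc w) σ →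
           ∃ λ τ → τ ∈ perms (suc w) × KingC w τ × τ ∷ʳ suc w ≡ σ
    from {σ} σ∈ (kingB , ends) with initLast σ
    ... | τ ∷ʳ′ x with refl ← MaybeP.just-injective (trans (sym (last-∷ʳ τ x)) ends) =
      deleted τ (IsPerm-∷ʳ⁻ (∈-perms⁻ (suc (suc w)) σ∈)) kingB
      where
      deleted : ∀ τ → IsPerm (suc w) τ → KingB (τ ∷ʳ suc w) →
                ∃ λ τ′ → τ′ ∈ perms (suc w) × KingC w τ′ × τ′ ∷ʳ suc w ≡ τ ∷ʳ suc w
      deleted []      (isPerm _ _ ()) _
      deleted (y ∷ τ) perm            kingB = y ∷ τ , ∈-perms⁺ (suc w) perm , King-∷ʳ⁻ y τ kingB , refl

module KingCounts where

  open ListCounting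
  open Permutations using (perms)
  open PowerSeries
  open InclusionExclusion using (king?; kings≡explicitSeries)
  open FinWords
  open Bijections
  open import Data.Nat as ℕ using (ℕ; zero; suc)
  open import Data.Integer as ℤ using (+_; _+_)
  import Data.Integer.Properties as ℤP
  open import Data.List using ([]; _∷_; map; upTo; filter; length)
  import Data.List.Properties as LP
  open import Data.Product using (_×_; _,_)
  open import Relation.Unary.Properties using (_∩?_)
  open import Relation.Binary.PropositionalEquality
  open import Function using (_∘_)

  Acount-suc : ∀ v → Acount (suc v) ≡ Bcount (suc v) ℕ.+ Bcount v
  Acount-suc v = begin
    Acount (suc v)
      ≡⟨ Acount-perms (suc v) ⟩
    length (filter king? (perms (suc v)))
      ≡⟨ length-filter-split king? startsWith0? (perms (suc v)) ⟩
    length (filter kingB? (perms (suc v))) ℕ.+ length (filter (king? ∩? startsWith0?) (perms (suc v)))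
      ≡⟨ cong₂ ℕ._+_ (Bcount-perms (suc v)) (trans (Bcount-perms v) (sym (startingWith0≡kingB v))) ⟨
    Bcount (suc v) ℕ.+ Bcount v ∎
    where open ≡-Reasoning

  Bcount-suc : ∀ w → Bcount (suc (suc w)) ≡ Ccount (suc (suc w)) ℕ.+ Ccount (suc w)
  Bcount-suc w = begin
    Bcount (suc (suc w))
      ≡⟨ Bcount-perms (suc (suc w)) ⟩
    length (filter kingB? (perms (suc (suc w))))
      ≡⟨ length-filter-split kingB? (endsWith? (suc w)) (perms (suc (suc w))) ⟩
    length (filter (kingC? (suc w)) (perms (suc (suc w)))) ℕ.+ length (filter (kingB? ∩? endsWith? (suc w)) (perms (suc (suc w))))
      ≡⟨ cong₂ ℕ._+_ (Ccount-perms (suc (suc w))) (trans (Ccount-perms (suc w)) (sym (endingWithMax≡kingC w))) ⟨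
    Ccount (suc (suc w)) ℕ.+ Ccount (suc w) ∎
    where open ≡-Reasoning

  Bcount-div1+t : ∀ n → + Bcount n ≡ div1+t Aser n
  Bcount-div1+t = div1+t-unique Aser (λ n → + Bcount n) refl λ m → trans (sym (ℤP.pos-+ (Bcount (suc m)) (Bcount m))) (cong +_ (sym (Acount-suc m)))

  Ccount-div1+t-tser⊕div1+t-Aser : ∀ n → + Ccount n ≡ div1+t (tser ⊕ div1+t Aser) n
  Ccount-div1+t-tser⊕div1+t-Aser = div1+t-unique (tser ⊕ div1+t Aser) (λ n → + Ccount n) refl step
    where
    step : ∀ m → + Ccount (suc m) + + Ccount m ≡ (tser ⊕ div1+t Aser) (suc m)
    step zero    = refl
    step (suc w) = begin
      + Ccount (suc (suc w)) + + Ccount (suc w)   ≡⟨ ℤP.pos-+ (Ccount (suc (suc w))) (Ccount (suc w)) ⟨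
      + (Ccount (suc (suc w)) ℕ.+ Ccount (suc w)) ≡⟨ cong +_ (Bcount-suc w) ⟨
      + Bcount (suc (suc w))                      ≡⟨ Bcount-div1+t (suc (suc w)) ⟩
      div1+t Aser (suc (suc w))                   ≡⟨ ℤP.+-identityˡ _ ⟨
      (tser ⊕ div1+t Aser) (suc (suc w))          ∎
      where open ≡-Reasoning

  Aser≡explicitSeries : ∀ n → Aser n ≡ explicitSeries 0 n
  Aser≡explicitSeries zero    = refl
  Aser≡explicitSeries (suc m) = trans (cong +_ (Acount-perms (suc m))) (kings≡explicitSeries m)

  div1+t^-Aser : ∀ k n → div1+t^ k Aser n ≡ explicitSeries k n
  div1+t^-Aser zero    n = Aser≡explicitSeries n
  div1+t^-Aser (suc k) n = trans (div1+t-cong (div1+t^-Aser k) n) (sym (explicitSeries-suc k n))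

  Bcount-explicitSeries : ∀ n → + Bcount n ≡ explicitSeries 1 n
  Bcount-explicitSeries n = trans (Bcount-div1+t n) (div1+t^-Aser 1 n)

  Ccount-div1+t : ∀ n → + Ccount n ≡ (div1+t tser ⊕ div1+t (div1+t Aser)) n
  Ccount-div1+t n = trans (Ccount-div1+t-tser⊕div1+t-Aser n) (div1+t-⊕ tser (div1+t Aser) n)

  Ccount-explicitSeries : ∀ n → + Ccount n ≡ (div1+t tser ⊕ explicitSeries 2) n
  Ccount-explicitSeries n = trans (Ccount-div1+t n) (cong (_+_ (div1+t tser n)) (div1+t^-Aser 2 n))

  -- Normalising Bcount k itself would enumerate all k^k words; the explicit series are cheap.
  Bcount-upTo-11 : map Bcount (upTo 11) ≡ 1 ∷ 0 ∷ 0 ∷ 0 ∷ 2 ∷ 12 ∷ 78 ∷ 568 ∷ 4674 ∷ 42948 ∷ 436358 ∷ []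
  Bcount-upTo-11 = LP.map-cong {f = Bcount} {g = λ k → ℤ.∣ explicitSeries 1 k ∣} (cong ℤ.∣_∣ ∘ Bcount-explicitSeries) (upTo 11)

  Ccount-upTo-11 : map Ccount (upTo 11) ≡ 1 ∷ 0 ∷ 0 ∷ 0 ∷ 2 ∷ 10 ∷ 68 ∷ 500 ∷ 4174 ∷ 38774 ∷ 397584 ∷ []
  Ccount-upTo-11 =
    LP.map-cong {f = Ccount} {g = λ k → ℤ.∣ (div1+t tser ⊕ explicitSeries 2) k ∣} (cong ℤ.∣_∣ ∘ Ccount-explicitSeries) (upTo 11)

open KingCounts

lemma2p1 : ((n : ℕ) →
               ((+ Bcount n) ≡ div1+t Aser n)
             × ((+ Bcount n) ≡ explicitSeries 1 n)
             × ((+ Ccount n) ≡ (div1+t tser ⊕ div1+t (div1+t Aser)) n)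
             × ((+ Ccount n) ≡ (div1+t tser ⊕ explicitSeries 2) n))
           × (map Bcount (upTo 11) ≡ 1 ∷ 0 ∷ 0 ∷ 0 ∷ 2 ∷ 12 ∷ 78 ∷ 568 ∷ 4674 ∷ 42948 ∷ 436358 ∷ [])
           × (map Ccount (upTo 11) ≡ 1 ∷ 0 ∷ 0 ∷ 0 ∷ 2 ∷ 10 ∷ 68 ∷ 500 ∷ 4174 ∷ 38774 ∷ 397584 ∷ [])
lemma2p1 =
  (λ n → Bcount-div1+t n , Bcount-explicitSeries n , Ccount-div1+t n , Ccount-explicitSeries n)
  , Bcount-upTo-11 , Ccount-upTo-11
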